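{- Let $w$ be a prefix-shuffle. Let $h_1<\dots<h_k$ be the dangling heads and $h'_1<\dots<h'_l$ the rooting heads of the prefix-map $M_w$, ordered by order of appearance around $T_w$. Then the prefix-forest $F_w$ is a collection of $k+l$ trees $t_1,\dots,t_k,t'_1,\dots,t'_l$, where $t_i$ is rooted at $h_i$ ($1\le i\le k$) and $t'_i$ is rooted at $h'_i$ ($1\le i\le l$), and the tree-sequence $\lambda_0(w)$ equals $u\,t_1\,u\cdots u\,t_k\,u\,t'_l\,v\cdots v\,t'_1\,v$.
   Context: A prefix-shuffle is a word $w$ on $\{a,\bar a,b,\bar b\}$ such that every prefix $w'$ satisfies $|w'|_a\ge|w'|_{\bar a}$ and $|w'|_b\ge|w'|_{\bar b}$. Let $w_a$ (resp. $w_b$) be the subword of letters in $\{a,\bar a\}$ (resp. $\{b,\bar b\}$); an occurrence of $c\in\{a,b\}$ is paired with an occurrence of $\bar c$ if the subword of $w_c$ strictly between them is a parenthesis system. Let $w_a^+$ be $w_a$ followed by $|w|_a-|w|_{\bar a}$ letters $\bar a$. Let $T_w$ be the planted plane tree whose tour (following its border counterclockwise from the root, writing $a$ the first time an edge is followed and $\bar a$ the second time) gives $w_a^+$; orient its edges away from the root-vertex (the root counts as a head). The prefix-map $M_w$ is obtained by reading $w$ while touring $T_w$ according to the letters $a,\bar a$, inserting at the current corner a head for each letter $b$ and a tail for each letter $\bar b$, and connecting the head and tail of each paired $b,\bar b$; heads of unpaired $b$'s are dangling heads. Edges of $T_w$ of unpaired letters $a$ are active. The heads of active edges, together with the root, are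 the rooting heads. The prefix-forest $F_w$ is obtained from $M_w$ by deleting the tails of active edges and then applying vertex explosion: each vertex $v$ is replaced by as many vertices as heads incident to $v$, each new vertex carrying one head $h$ together with the tails $t$ of $v$ for which $h$ is the first head met turning counterclockwise around $v$ from $t$. Trees: planted plane trees; $\tau$ is the tree with one vertex and a root and no edges. For trees $T_1,T_2$, $\sigma(T_1,T_2)$ is the tree obtained from $T_2$ by adding a new edge from the root-vertex of $T_2$, placed as its last edge around that vertex in the tour order, to the root-vertex of $T_1$, the head of this edge playing the role of the root of $T_1$. A tree-sequence is a word $u t_1 u\cdots t_{i-1} u t_i v t_{i+1}\cdots t_k v$ ($1\le i\le k$, $t_j$ trees). $\lambda_0$ is defined recursively: $\lambda_0(\epsilon)=u\tau v$; $\lambda_0(w'a)$: replace the last $u$ of $\lambda_0(w')$ by $u\tau v$; $\lambda_0(w'b)$: replace the first $v$ by $u\tau v$; $\lambda_0(w'\bar a)$: replace the subword $T_1vT_2$ around the first $v$ by $\sigma(T_1,T_2)$; $\lambda_0(w'\bar b)$: replace the subword $T_1uT_2$ around the last $u$ by $\sigma(T_1,T_2)$. -}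

module Defs where

open import Data.Nat using (ℕ; zero; suc; _+_; _∸_; _≥_; _<ᵇ_)
open import Data.Bool using (Bool; true; false; _∧_; _∨_; not; if_then_else_)
open import Data.List using (List; []; _∷_; _++_; [_]; map; reverse; take; drop; length; concatMap; upTo; filter)
open import Data.Bool.ListAction using (any)
open import Data.Bool using (T?)
open import Data.Maybe using (Maybe; just; nothing; _>>=_)
open import Data.Product using (_×_; _,_; proj₁; proj₂)
open import Relation.Binary.PropositionalEquality using (_≡_)
open import Data.List.Membership.Propositional using (_∈_)

data Letter : Set where
  a a̅ b b̅ : Letter

Word : Set
Word = List Letter

isL : Letter → Letter → Bool
isL a a = true
isL a̅ a̅ = true
isL b b = true
isL b̅ b̅ = true
isL _ _ = false

count : Letter → Word → ℕ
count ℓ [] = 0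
count ℓ (x ∷ xs) = if isL ℓ x then suc (count ℓ xs) else count ℓ xs

PrefixShuffle : Word → Set
PrefixShuffle w = ∀ n → (count a (take n w) ≥ count a̅ (take n w))
                       × (count b (take n w) ≥ count b̅ (take n w))

inA : Letter → Bool
inA a = true
inA a̅ = true
inA _ = false

inB : Letter → Bool
inB b = true
inB b̅ = true
inB _ = false

sub : (Letter → Bool) → Word → Word
sub p [] = []
sub p (x ∷ xs) = if p x then x ∷ sub p xs else sub p xs

dyckFrom : Letter → Letter → ℕ → Word → Bool
dyckFrom o c zero [] = true
dyckFrom o c (suc d) [] = false
dyckFrom o c d (x ∷ xs) =
  if isL o x then dyckFrom o c (suc d) xs
  else if isL c x then (dyckStep d xs)
  else false
  where
  dyckStep : ℕ → Word → Bool
  dyckStep zero _ = false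
  dyckStep (suc d') ys = dyckFrom o c d' ys

ParSys : Letter → Letter → Word → Bool
ParSys o c = dyckFrom o c 0

-- the letter at position i (positions start at 0)
at : Word → ℕ → Maybe Letter
at [] _ = nothing
at (x ∷ xs) zero = just x
at (x ∷ xs) (suc i) = at xs i

between : Word → ℕ → ℕ → Word
between w i j = take (j ∸ suc i) (drop (suc i) w)

isAt : Word → ℕ → Letter → Bool
isAt w i ℓ with at w i
... | just x = isL ℓ x
... | nothing = false

paired : Word → ℕ → ℕ → Bool
paired w i j =
  (i <ᵇ j) ∧
  ((isAt w i a ∧ isAt w j a̅ ∧ ParSys a a̅ (sub inA (between w i j))) ∨
   (isAt w i b ∧ isAt w j b̅ ∧ ParSys b b̅ (sub inB (between w i j))))

unpaired : Word → ℕ → Bool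
unpaired w i = not (any (paired w i) (upTo (length w)))

positions : Word → List ℕ
positions w = upTo (length w)

-- Half-edges of the prefix-map M_w, named by the position of the letter
-- of w that creates them.

data HE : Set where
  root : HE
  aH   : ℕ → HE      -- head of the edge of T_w of the letter a at position i
  aT   : ℕ → HE      -- tail of that edge
  bH   : ℕ → HE      -- head inserted for the letter b at position i
  bT   : ℕ → HE      -- tail inserted for the letter b̄ at position j

isHead : HE → Bool
isHead root = true
isHead (aH _) = true
isHead (bH _) = true
isHead _ = false

-- A vertex: its distinguished head (the root, or the head of the edge of
-- T_w leading to it) together with the list of the other half-edges
-- incident to it, in counterclockwise order starting from that head
-- (this is the chronological order of the tour of T_w).
Vertex : Set
Vertex = HE × List HE

-- The state is the stack of vertices from
-- the current vertex up to the root-vertex (each with its incidences in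
-- reverse order), and the list of vertices already left for good.
record TourState : Set where
  constructor st
  field
    stack : List Vertex
    done  : List Vertex

addInc : HE → List Vertex → List Vertex
addInc e [] = []
addInc e ((h , inc) ∷ s) = (h , e ∷ inc) ∷ s

close : Vertex → Vertex
close (h , inc) = (h , reverse inc)

step : ℕ → Letter → TourState → TourState
step i a (st s d) = st ((aH i , []) ∷ addInc (aT i) s) d
step i a̅ (st (v ∷ s@(_ ∷ _)) d) = st s (close v ∷ d)
step i a̅ σ = σ   -- never happens for a prefix-shuffle
step i b (st s d) = st (addInc (bH i) s) d
step i b̅ (st s d) = st (addInc (bT i) s) d

tourFrom : ℕ → Word → TourState → TourState
tourFrom i [] σ = σ
tourFrom i (x ∷ xs) σ = tourFrom (suc i) xs (step i x σ)

-- after w, the remaining letters ā of w_a^+ close all remaining vertices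
finish : TourState → List Vertex
finish (st s d) = map close s ++ d

mapVertices : Word → List Vertex
mapVertices w = finish (tourFrom 0 w (st ((root , []) ∷ []) []))

active : Word → ℕ → Bool
active w i = isAt w i a ∧ unpaired w i

rootingHeads : Word → List HE
rootingHeads w = root ∷ map aH (filter (λ i → T? (active w i)) (positions w))

danglingHeads : Word → List HE
danglingHeads w = map bH (filter (λ i → T? (isAt w i b ∧ unpaired w i)) (positions w))

keep : Word → HE → Bool
keep w (aT i) = not (active w i)
keep w _ = true

deleteActive : Word → Vertex → Vertex
deleteActive w (h , inc) = (h , sub' inc)
  where
  sub' : List HE → List HE
  sub' [] = []
  sub' (x ∷ xs) = if keep w x then x ∷ sub' xs else sub' xs

-- vertex explosion: one new vertex per head; each tail goes with the
-- first head met turning counterclockwise from it (i.e. the next head in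
-- the cyclic counterclockwise order).  The tails of a new vertex are
-- listed counterclockwise starting from its head.
explodeGo : HE → List HE → List HE → List Vertex
explodeGo h0 acc [] = (h0 , reverse acc) ∷ []
explodeGo h0 acc (x ∷ xs) =
  if isHead x then (x , reverse acc) ∷ explodeGo h0 [] xs
  else explodeGo h0 (x ∷ acc) xs

explode : Vertex → List Vertex
explode (h0 , inc) = explodeGo h0 [] inc

forest : Word → List Vertex
forest w = concatMap (λ v → explode (deleteActive w v)) (mapVertices w)

data Edge (w : Word) : HE → HE → Set where
  aEdge : ∀ i → Edge w (aT i) (aH i)
  bEdge : ∀ i j → paired w i j ≡ true → Edge w (bT j) (bH i)

-- Planted plane trees, with children listed in tour order

data Tree : Set where
  node : List Tree → Tree

τ : Tree
τ = node []

σ : Tree → Tree → Tree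
σ T₁ (node cs) = node (cs ++ [ T₁ ])

data LTree : Set where
  lnode : HE → List LTree → LTree

label : LTree → HE
label (lnode h _) = h

erase : LTree → Tree
eraseL : List LTree → List Tree
erase (lnode _ cs) = node (eraseL cs)
eraseL [] = []
eraseL (c ∷ cs) = erase c ∷ eraseL cs

headsOf : LTree → List HE
headsOfL : List LTree → List HE
headsOf (lnode h cs) = h ∷ headsOfL cs
headsOfL [] = []
headsOfL (c ∷ cs) = headsOf c ++ headsOfL cs

data Rooted (w : Word) (F : List Vertex) : LTree → Set
data RootedL (w : Word) (F : List Vertex) : List HE → List LTree → Set

data Rooted w F where
  rnode : ∀ {h ts cs} → (h , ts) ∈ F → RootedL w F ts cs → Rooted w F (lnode h cs)

data RootedL w F where
  []  : RootedL w F [] []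
  _∷_ : ∀ {t ts c cs} → Edge w t (label c) × Rooted w F c → RootedL w F ts cs
        → RootedL w F (t ∷ ts) (c ∷ cs)

data Sym : Set where
  u v : Sym
  tr  : Tree → Sym

TreeSeq : Set
TreeSeq = List Sym

firstV : TreeSeq → Maybe TreeSeq
firstV [] = nothing
firstV (v ∷ xs) = just (u ∷ tr τ ∷ v ∷ xs)
firstV (x ∷ xs) = firstV xs >>= λ ys → just (x ∷ ys)

aroundFirstV : TreeSeq → Maybe TreeSeq
aroundFirstV (tr T₁ ∷ v ∷ tr T₂ ∷ xs) = just (tr (σ T₁ T₂) ∷ xs)
aroundFirstV (tr T₁ ∷ v ∷ _) = nothing
aroundFirstV (v ∷ _) = nothing
aroundFirstV [] = nothing
aroundFirstV (x ∷ xs) = aroundFirstV xs >>= λ ys → just (x ∷ ys)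

firstURev : TreeSeq → Maybe TreeSeq
firstURev [] = nothing
firstURev (u ∷ xs) = just (v ∷ tr τ ∷ u ∷ xs)
firstURev (x ∷ xs) = firstURev xs >>= λ ys → just (x ∷ ys)

aroundFirstURev : TreeSeq → Maybe TreeSeq
aroundFirstURev (tr T₂ ∷ u ∷ tr T₁ ∷ xs) = just (tr (σ T₁ T₂) ∷ xs)
aroundFirstURev (tr T₂ ∷ u ∷ _) = nothing
aroundFirstURev (u ∷ _) = nothing
aroundFirstURev [] = nothing
aroundFirstURev (x ∷ xs) = aroundFirstURev xs >>= λ ys → just (x ∷ ys)

viaReverse : (TreeSeq → Maybe TreeSeq) → TreeSeq → Maybe TreeSeq
viaReverse f s = f (reverse s) >>= λ r → just (reverse r)

λstep : Letter → TreeSeq → Maybe TreeSeq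
λstep a  = viaReverse firstURev          -- replace the last u by u τ v
λstep b  = firstV                        -- replace the first v by u τ v
λstep a̅ = aroundFirstV                   -- T₁ v T₂ around the first v ↦ σ(T₁,T₂)
λstep b̅ = viaReverse aroundFirstURev     -- T₁ u T₂ around the last u ↦ σ(T₁,T₂)

-- λ₀(w), computed letter by letter from λ₀(ε) = u τ v
-- (`nothing` if some step is undefined)
λ₀From : TreeSeq → Word → Maybe TreeSeq
λ₀From s [] = just s
λ₀From s (x ∷ xs) = λstep x s >>= λ s' → λ₀From s' xs

λ₀ : Word → Maybe TreeSeq
λ₀ = λ₀From (u ∷ tr τ ∷ v ∷ [])

expectedSeq : List Tree → List Tree → TreeSeq
expectedSeq ts ts' =
  concatMap (λ t → u ∷ tr t ∷ []) ts ++ [ u ] ++ concatMap (λ t → tr t ∷ v ∷ []) (reverse ts')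

{-# OPTIONS --safe #-}
-- Induction on w, one letter at a time, maintaining three structures.  The stacks of unpaired a's
-- and b's: an opener is paired with a new closing letter exactly when it is on top of its stack.  The
-- tour of T_w: its stack of vertices is the path from the current vertex down to the root-vertex through
-- the edges of the unpaired a's, which are the active edges.  A decomposition of F_w, read off the tour,
-- into one dangling tree per unpaired b and one rooting tree per unpaired a, plus the one of the root.
-- Each letter acts on the decomposition as the rules of λ₀ act on tree-sequences: a starts a rooting
-- tree τ; b hands the subtrees of the top rooting vertex to a new dangling head, leaving τ behind; a̅
-- makes the top rooting tree the last child of the next rooting vertex, and b̅ makes the latest dangling
-- tree the last child of the top rooting vertex; both are instances of σ.

module Submission where

open import Defs
open import Data.Bool using (Bool; true; false; _∧_; _∨_; not; T; T?; if_then_else_)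
open import Data.Bool.Properties using (T-≡; ∨-identityʳ; ∨-zeroʳ; ∨-assoc; ∧-identityʳ; ∧-zeroʳ; ∧-assoc)
open import Data.Bool.ListAction using (any; or)
open import Data.Empty using (⊥-elim)
open import Data.List using (List; []; _∷_; _++_; [_]; _∷ʳ_; map; length; drop; take; upTo; reverse; concatMap; filter)
open import Data.List.Membership.Propositional using (_∈_)
open import Data.List.Membership.Propositional.Properties using (∈-upTo⁻; ∈-++⁻; ∈-++⁺ˡ; ∈-++⁺ʳ)
open import Data.List.Properties as List using ()
open import Data.List.Relation.Binary.Permutation.Propositional using (_↭_; ↭-refl; ↭-sym; ↭-trans; prep; ↭-reflexive; ↭⇒↭ₛ; module PermutationReasoning)
import Data.List.Relation.Binary.Permutation.Propositional.Properties as Perm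
import Data.List.Relation.Binary.Permutation.Setoid.Properties as PermSetoid
open import Data.List.Relation.Unary.All as All using (All; []; _∷_)
open import Data.List.Relation.Unary.All.Properties as All using ()
open import Data.List.Relation.Unary.AllPairs using (AllPairs; []; _∷_)
import Data.List.Relation.Unary.AllPairs.Properties as AllPairs
open import Data.List.Relation.Unary.Any using (here; there)
open import Data.List.Relation.Unary.Unique.Propositional using (Unique)
open import Data.List.Reverse using (Reverse; []; _∶_∶ʳ_; reverseView)
open import Data.Maybe using (Maybe; just; nothing; _>>=_)
import Data.Maybe as Maybe
open import Data.Nat using (ℕ; zero; suc; _+_; _∸_; _<_; _≤_; _>_; _≥_; _≡ᵇ_; _<ᵇ_; z≤n; s≤s)
open import Data.Nat.Properties as ℕ using ()
open import Data.Product using (Σ; _×_; _,_; proj₁; proj₂)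
open import Data.Sum using (inj₁; inj₂)
open import Data.Unit using (⊤)
open import Function.Bundles using (Equivalence)
open import Relation.Binary.Definitions using (tri<; tri≈; tri>)
open import Relation.Binary.PropositionalEquality using (_≡_; _≢_; refl; sym; trans; cong; cong₂; subst; subst₂; setoid; module ≡-Reasoning)
open import Relation.Nullary using (Dec; yes; no)

T⇒≡true : ∀ {x} → T x → x ≡ true
T⇒≡true = Equivalence.to T-≡

≡true⇒T : ∀ {x} → x ≡ true → T x
≡true⇒T = Equivalence.from T-≡

≡ᵇ-refl : ∀ n → (n ≡ᵇ n) ≡ true
≡ᵇ-refl n = T⇒≡true (ℕ.≡⇒≡ᵇ n n refl)

≡ᵇ-true⇒≡ : ∀ m n → (m ≡ᵇ n) ≡ true → m ≡ n
≡ᵇ-true⇒≡ m n e = ℕ.≡ᵇ⇒≡ m n (≡true⇒T e)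

≢⇒≡ᵇ-false : ∀ {m n} → m ≢ n → (m ≡ᵇ n) ≡ false
≢⇒≡ᵇ-false {m} {n} m≢n with m ≡ᵇ n in e
... | false = refl
... | true = ⊥-elim (m≢n (≡ᵇ-true⇒≡ m n e))

<⇒≡ᵇ-false : ∀ {m n} → m < n → (m ≡ᵇ n) ≡ false
<⇒≡ᵇ-false m<n = ≢⇒≡ᵇ-false (ℕ.<⇒≢ m<n)

>⇒≡ᵇ-false : ∀ {m n} → m > n → (m ≡ᵇ n) ≡ false
>⇒≡ᵇ-false m>n = ≢⇒≡ᵇ-false (ℕ.>⇒≢ m>n)

<⇒<ᵇ-true : ∀ {m n} → m < n → (m <ᵇ n) ≡ true
<⇒<ᵇ-true m<n = T⇒≡true (ℕ.<⇒<ᵇ m<n)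

≥⇒<ᵇ-false : ∀ m n → n ≤ m → (m <ᵇ n) ≡ false
≥⇒<ᵇ-false m n n≤m with m <ᵇ n in e
... | false = refl
... | true = ⊥-elim (ℕ.<⇒≱ (ℕ.<ᵇ⇒< m n (≡true⇒T e)) n≤m)

take-++-≤ : ∀ {A : Set} n (xs ys : List A) → n ≤ length xs → take n (xs ++ ys) ≡ take n xs
take-++-≤ zero xs ys _ = refl
take-++-≤ (suc n) (x ∷ xs) ys (s≤s n≤) = cong (x ∷_) (take-++-≤ n xs ys n≤)

drop-++-≤ : ∀ {A : Set} n (xs ys : List A) → n ≤ length xs → drop n (xs ++ ys) ≡ drop n xs ++ ys
drop-++-≤ zero xs ys _ = refl
drop-++-≤ (suc n) (x ∷ xs) ys (s≤s n≤) = drop-++-≤ n xs ys n≤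

not-∨ : ∀ x y → not (x ∨ y) ≡ not x ∧ not y
not-∨ true y = refl
not-∨ false y = refl

any-∷ʳ : ∀ {A : Set} (f : A → Bool) xs y → any f (xs ∷ʳ y) ≡ any f xs ∨ f y
any-∷ʳ f [] y = ∨-identityʳ (f y)
any-∷ʳ f (x ∷ xs) y = trans (cong (f x ∨_) (any-∷ʳ f xs y)) (sym (∨-assoc (f x) (any f xs) (f y)))

any-cong-local : ∀ {A : Set} {f g : A → Bool} {xs} → All (λ x → f x ≡ g x) xs → any f xs ≡ any g xs
any-cong-local f≡g = cong or (List.map-cong-local f≡g)

any-false : ∀ {A : Set} {f : A → Bool} {xs} → All (λ x → f x ≡ false) xs → any f xs ≡ false
any-false [] = refl
any-false (fx ∷ fxs) rewrite fx = any-false fxs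

all-upTo : ∀ n → All (_< n) (upTo n)
all-upTo n = All.tabulate ∈-upTo⁻

All-reverse : ∀ {A : Set} {P : A → Set} {xs} → All P xs → All P (reverse xs)
All-reverse {xs = xs} = Perm.All-resp-↭ (↭-sym (Perm.↭-reverse xs))

length-∷ʳ : ∀ {A : Set} (xs : List A) x → length (xs ∷ʳ x) ≡ suc (length xs)
length-∷ʳ [] x = refl
length-∷ʳ (_ ∷ xs) x = cong suc (length-∷ʳ xs x)

isL-refl : ∀ ℓ → isL ℓ ℓ ≡ true
isL-refl a = refl
isL-refl a̅ = refl
isL-refl b = refl
isL-refl b̅ = refl

isL⇒≡ : ∀ ℓ x → isL ℓ x ≡ true → x ≡ ℓ
isL⇒≡ a a _ = refl
isL⇒≡ a̅ a̅ _ = refl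
isL⇒≡ b b _ = refl
isL⇒≡ b̅ b̅ _ = refl
isL⇒≡ a a̅ ()
isL⇒≡ a b ()
isL⇒≡ a b̅ ()
isL⇒≡ a̅ a ()
isL⇒≡ a̅ b ()
isL⇒≡ a̅ b̅ ()
isL⇒≡ b a ()
isL⇒≡ b a̅ ()
isL⇒≡ b b̅ ()
isL⇒≡ b̅ a ()
isL⇒≡ b̅ a̅ ()
isL⇒≡ b̅ b ()

at-∷ʳ-< : ∀ (w : Word) x {i} → i < length w → at (w ∷ʳ x) i ≡ at w i
at-∷ʳ-< (y ∷ w) x {zero} _ = refl
at-∷ʳ-< (y ∷ w) x {suc i} (s≤s i<) = at-∷ʳ-< w x i<

at-∷ʳ-length : ∀ (w : Word) x → at (w ∷ʳ x) (length w) ≡ just x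
at-∷ʳ-length [] x = refl
at-∷ʳ-length (y ∷ w) x = at-∷ʳ-length w x

at-≥ : ∀ (w : Word) {i} → length w ≤ i → at w i ≡ nothing
at-≥ [] _ = refl
at-≥ (y ∷ w) {suc i} (s≤s ≤i) = at-≥ w ≤i

at-just⇒< : ∀ (w : Word) i {y} → at w i ≡ just y → i < length w
at-just⇒< (x ∷ w) zero _ = s≤s z≤n
at-just⇒< (x ∷ w) (suc i) e = s≤s (at-just⇒< w i e)

isLetter : Letter → Maybe Letter → Bool
isLetter ℓ (just x) = isL ℓ x
isLetter ℓ nothing = false

isAt-at : ∀ w i ℓ → isAt w i ℓ ≡ isLetter ℓ (at w i)
isAt-at w i ℓ with at w i
... | just x = refl
... | nothing = refl

isAt-∷ʳ-< : ∀ w x {i} ℓ → i < length w → isAt (w ∷ʳ x) i ℓ ≡ isAt w i ℓ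
isAt-∷ʳ-< w x {i} ℓ i< =
  trans (isAt-at (w ∷ʳ x) i ℓ) (trans (cong (isLetter ℓ) (at-∷ʳ-< w x i<)) (sym (isAt-at w i ℓ)))

isAt-∷ʳ-length : ∀ w x ℓ → isAt (w ∷ʳ x) (length w) ℓ ≡ isL ℓ x
isAt-∷ʳ-length w x ℓ = trans (isAt-at (w ∷ʳ x) (length w) ℓ) (cong (isLetter ℓ) (at-∷ʳ-length w x))

isAt-≥ : ∀ w {i} ℓ → length w ≤ i → isAt w i ℓ ≡ false
isAt-≥ w {i} ℓ ≤i = trans (isAt-at w i ℓ) (cong (isLetter ℓ) (at-≥ w ≤i))

isAt⇒at : ∀ w i ℓ → isAt w i ℓ ≡ true → at w i ≡ just ℓ
isAt⇒at w i ℓ e = isLetter⇒≡just (at w i) (trans (sym (isAt-at w i ℓ)) e)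
  where
  isLetter⇒≡just : ∀ m → isLetter ℓ m ≡ true → m ≡ just ℓ
  isLetter⇒≡just (just x) e′ = cong just (isL⇒≡ ℓ x e′)

isAt⇒< : ∀ w i ℓ → isAt w i ℓ ≡ true → i < length w
isAt⇒< w i ℓ e = at-just⇒< w i (isAt⇒at w i ℓ e)

isAt-determines : ∀ w i ℓ ℓ′ → isAt w i ℓ ≡ true → isAt w i ℓ′ ≡ isL ℓ′ ℓ
isAt-determines w i ℓ ℓ′ e = trans (isAt-at w i ℓ′) (cong (isLetter ℓ′) (isAt⇒at w i ℓ e))

between-∷ʳ : ∀ w x i j → i < j → j < length w → between (w ∷ʳ x) i j ≡ between w i j
between-∷ʳ w x i j i<j j<n =
  trans (cong (take (j ∸ suc i)) (drop-++-≤ (suc i) w [ x ] (ℕ.≤-trans i<j (ℕ.<⇒≤ j<n))))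
        (take-++-≤ (j ∸ suc i) (drop (suc i) w) [ x ]
          (subst (j ∸ suc i ≤_) (sym (List.length-drop (suc i) w)) (ℕ.∸-monoˡ-≤ (suc i) (ℕ.<⇒≤ j<n))))

between-∷ʳ-length : ∀ w x i → i < length w → between (w ∷ʳ x) i (length w) ≡ drop (suc i) w
between-∷ʳ-length w x i i<n =
  trans (cong (take (length w ∸ suc i)) (drop-++-≤ (suc i) w [ x ] i<n))
  (trans (cong (λ m → take m (drop (suc i) w ∷ʳ x)) (sym (List.length-drop (suc i) w)))
  (trans (take-++-≤ (length (drop (suc i) w)) (drop (suc i) w) [ x ] ℕ.≤-refl)
         (List.take-all (length (drop (suc i) w)) (drop (suc i) w) ℕ.≤-refl)))

paired-∷ʳ : ∀ w x i j → j < length w → paired (w ∷ʳ x) i j ≡ paired w i j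
paired-∷ʳ w x i j j<n with i <ᵇ j in e
... | false = refl
... | true with ℕ.<ᵇ⇒< i j (≡true⇒T e)
... | i<j
  rewrite isAt-∷ʳ-< w x a (ℕ.<-trans i<j j<n) | isAt-∷ʳ-< w x b (ℕ.<-trans i<j j<n)
        | isAt-∷ʳ-< w x a̅ j<n | isAt-∷ʳ-< w x b̅ j<n | between-∷ʳ w x i j i<j j<n = refl

paired⇒< : ∀ w i j → paired w i j ≡ true → j < length w
paired⇒< w i j e with j ℕ.<? length w
... | yes j<n = j<n
... | no j≮n
  rewrite isAt-≥ w a̅ (ℕ.≮⇒≥ j≮n) | isAt-≥ w b̅ (ℕ.≮⇒≥ j≮n)
        | ∧-zeroʳ (isAt w i a) | ∧-zeroʳ (isAt w i b) | ∧-zeroʳ (i <ᵇ j) with e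
... | ()

Edge-∷ʳ : ∀ w x {t h} → Edge w t h → Edge (w ∷ʳ x) t h
Edge-∷ʳ w x (aEdge i) = aEdge i
Edge-∷ʳ w x (bEdge i j e) = bEdge i j (trans (paired-∷ʳ w x i j (paired⇒< w i j e)) e)

unpaired-∷ʳ : ∀ w x i → unpaired (w ∷ʳ x) i ≡ unpaired w i ∧ not (paired (w ∷ʳ x) i (length w))
unpaired-∷ʳ w x i = begin
    not (any (paired (w ∷ʳ x) i) (upTo (length (w ∷ʳ x))))
  ≡⟨ cong (λ n → not (any (paired (w ∷ʳ x) i) (upTo n))) (length-∷ʳ w x) ⟩
    not (any (paired (w ∷ʳ x) i) (upTo (suc n)))
  ≡⟨ cong (λ js → not (any (paired (w ∷ʳ x) i) js)) (sym (List.upTo-∷ʳ n)) ⟩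
    not (any (paired (w ∷ʳ x) i) (upTo n ∷ʳ n))
  ≡⟨ cong not (any-∷ʳ (paired (w ∷ʳ x) i) (upTo n) n) ⟩
    not (any (paired (w ∷ʳ x) i) (upTo n) ∨ paired (w ∷ʳ x) i n)
  ≡⟨ cong (λ p → not (p ∨ paired (w ∷ʳ x) i n))
          (any-cong-local (All.map (paired-∷ʳ w x i _) (all-upTo n))) ⟩
    not (any (paired w i) (upTo n) ∨ paired (w ∷ʳ x) i n)
  ≡⟨ not-∨ (any (paired w i) (upTo n)) (paired (w ∷ʳ x) i n) ⟩
    unpaired w i ∧ not (paired (w ∷ʳ x) i n)
  ∎
  where
  n : ℕ
  n = length w
  open ≡-Reasoning

unpaired-∷ʳ-length : ∀ w x → unpaired (w ∷ʳ x) (length w) ≡ true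
unpaired-∷ʳ-length w x = cong not (any-false (All.map later (all-upTo (length (w ∷ʳ x)))))
  where
  later : ∀ {j} → j < length (w ∷ʳ x) → paired (w ∷ʳ x) (length w) j ≡ false
  later {j} j< rewrite ≥⇒<ᵇ-false (length w) j (ℕ.≤-pred (subst (j <_) (length-∷ʳ w x) j<)) = refl

data Kind : Set where
  kindA kindB : Kind

opening : Kind → Letter
opening kindA = a
opening kindB = b

closing : Kind → Letter
closing kindA = a̅
closing kindB = b̅

ofKind : Kind → Letter → Bool
ofKind kindA = inA
ofKind kindB = inB

data Move : Set where
  push pop skip : Move

move : Kind → Letter → Move
move kindA a = push
move kindA a̅ = pop
move kindB b = push
move kindB b̅ = pop
move _ _ = skip

isPush : Move → Bool
isPush push = true
isPush _ = false

isPop : Move → Bool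
isPop pop = true
isPop _ = false

opening-move : ∀ k x → isL (opening k) x ≡ isPush (move k x)
opening-move kindA a = refl
opening-move kindA a̅ = refl
opening-move kindA b = refl
opening-move kindA b̅ = refl
opening-move kindB a = refl
opening-move kindB a̅ = refl
opening-move kindB b = refl
opening-move kindB b̅ = refl

closing-move : ∀ k x → isL (closing k) x ≡ isPop (move k x)
closing-move kindA a = refl
closing-move kindA a̅ = refl
closing-move kindA b = refl
closing-move kindA b̅ = refl
closing-move kindB a = refl
closing-move kindB a̅ = refl
closing-move kindB b = refl
closing-move kindB b̅ = refl

perform : Move → ℕ → List ℕ → List ℕ
perform push i K = i ∷ K
perform pop i K = drop 1 K
perform skip i K = K

updateStack : Kind → ℕ → Letter → List ℕ → List ℕ
updateStack k i x = perform (move k x) i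

openStackFrom : Kind → ℕ → List ℕ → Word → List ℕ
openStackFrom k i K [] = K
openStackFrom k i K (x ∷ xs) = openStackFrom k (suc i) (updateStack k i x K) xs

-- Positions of the unpaired openers of kind k, the most recent first.
openStack : Kind → Word → List ℕ
openStack k = openStackFrom k 0 []

openStackFrom-∷ʳ : ∀ k i K xs x →
  openStackFrom k i K (xs ∷ʳ x) ≡ updateStack k (i + length xs) x (openStackFrom k i K xs)
openStackFrom-∷ʳ k i K [] x = cong (λ j → updateStack k j x K) (sym (ℕ.+-identityʳ i))
openStackFrom-∷ʳ k i K (y ∷ xs) x =
  trans (openStackFrom-∷ʳ k (suc i) (updateStack k i y K) xs x)
        (cong (λ j → updateStack k j x (openStackFrom k (suc i) (updateStack k i y K) xs)) (sym (ℕ.+-suc i (length xs))))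

openStack-∷ʳ : ∀ k w x → openStack k (w ∷ʳ x) ≡ updateStack k (length w) x (openStack k w)
openStack-∷ʳ k w x = openStackFrom-∷ʳ k 0 [] w x

moveDepth : Move → ℕ → Maybe ℕ
moveDepth push d = just (suc d)
moveDepth pop zero = nothing
moveDepth pop (suc d) = just d
moveDepth skip d = just d

-- The nesting depth of kind k after reading a word from depth d; nothing once it would become negative.
walk : Kind → ℕ → Word → Maybe ℕ
walk k d [] = just d
walk k d (x ∷ xs) = moveDepth (move k x) d >>= λ e → walk k e xs

walk-∷ʳ : ∀ k d s x → walk k d (s ∷ʳ x) ≡ (walk k d s >>= moveDepth (move k x))
walk-∷ʳ k d [] x with moveDepth (move k x) d
... | nothing = refl
... | just _ = refl
walk-∷ʳ k d (y ∷ s) x with moveDepth (move k y) d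
... | nothing = refl
... | just e = walk-∷ʳ k e s x

isJustZero : Maybe ℕ → Bool
isJustZero (just zero) = true
isJustZero _ = false

dyck-sub≡walk : ∀ k d s → dyckFrom (opening k) (closing k) d (sub (ofKind k) s) ≡ isJustZero (walk k d s)
dyck-sub≡walk k zero [] = refl
dyck-sub≡walk k (suc d) [] = refl
dyck-sub≡walk kindA zero (a ∷ s) = dyck-sub≡walk kindA 1 s
dyck-sub≡walk kindA (suc d) (a ∷ s) = dyck-sub≡walk kindA (suc (suc d)) s
dyck-sub≡walk kindA zero (a̅ ∷ s) = refl
dyck-sub≡walk kindA (suc d) (a̅ ∷ s) = dyck-sub≡walk kindA d s
dyck-sub≡walk kindA d (b ∷ s) = dyck-sub≡walk kindA d s
dyck-sub≡walk kindA d (b̅ ∷ s) = dyck-sub≡walk kindA d s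
dyck-sub≡walk kindB d (a ∷ s) = dyck-sub≡walk kindB d s
dyck-sub≡walk kindB d (a̅ ∷ s) = dyck-sub≡walk kindB d s
dyck-sub≡walk kindB zero (b ∷ s) = dyck-sub≡walk kindB 1 s
dyck-sub≡walk kindB (suc d) (b ∷ s) = dyck-sub≡walk kindB (suc (suc d)) s
dyck-sub≡walk kindB zero (b̅ ∷ s) = refl
dyck-sub≡walk kindB (suc d) (b̅ ∷ s) = dyck-sub≡walk kindB d s

depthOf : ℕ → List ℕ → Maybe ℕ
depthOf i [] = nothing
depthOf i (j ∷ K) = if i ≡ᵇ j then just zero else Maybe.map suc (depthOf i K)

isTop : ℕ → List ℕ → Bool
isTop i [] = false
isTop i (j ∷ K) = i ≡ᵇ j

mem : ℕ → List ℕ → Bool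
mem i [] = false
mem i (j ∷ K) = (i ≡ᵇ j) ∨ mem i K

isJustZero-depthOf : ∀ i K → isJustZero (depthOf i K) ≡ isTop i K
isJustZero-depthOf i [] = refl
isJustZero-depthOf i (j ∷ K) with i ≡ᵇ j
... | true = refl
... | false with depthOf i K
... | nothing = refl
... | just _ = refl

mem-here : ∀ j K → mem j (j ∷ K) ≡ true
mem-here j K rewrite ≡ᵇ-refl j = refl

mem-there : ∀ i j K → mem i K ≡ true → mem i (j ∷ K) ≡ true
mem-there i j K e rewrite e = ∨-zeroʳ (i ≡ᵇ j)

mem-fresh : ∀ {j K} → All (_< j) K → mem j K ≡ false
mem-fresh [] = refl
mem-fresh (k<j ∷ K<j) rewrite >⇒≡ᵇ-false k<j = mem-fresh K<j

depthOf-fresh : ∀ {j K} → All (_< j) K → depthOf j K ≡ nothing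
depthOf-fresh [] = refl
depthOf-fresh (k<j ∷ K<j) rewrite >⇒≡ᵇ-false k<j | depthOf-fresh K<j = refl

All-mem : ∀ {P : ℕ → Set} {K} i → All P K → mem i K ≡ true → P i
All-mem {K = j ∷ K} i (pj ∷ pK) e with i ≡ᵇ j in i≡ᵇj
... | true = subst _ (sym (≡ᵇ-true⇒≡ i j i≡ᵇj)) pj
... | false = All-mem i pK e

All-perform : ∀ {P : ℕ → Set} m n {K} → All P K → (isPush m ≡ true → P n) → All P (perform m n K)
All-perform push n pK pn = pn refl ∷ pK
All-perform pop n pK pn = All.drop⁺ 1 pK
All-perform skip n pK pn = pK

descending-perform : ∀ m {n K} → All (_< n) K → AllPairs _>_ K → AllPairs _>_ (perform m n K)
descending-perform push K<n desc = K<n ∷ desc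
descending-perform pop K<n desc = AllPairs.drop⁺ 1 desc
descending-perform skip K<n desc = desc

depthOf-perform : ∀ m {n i K} → i < n → AllPairs _>_ K → (depthOf i K >>= moveDepth m) ≡ depthOf i (perform m n K)
depthOf-perform push {i = i} {K} i<n desc rewrite <⇒≡ᵇ-false i<n with depthOf i K
... | nothing = refl
... | just _ = refl
depthOf-perform pop {K = []} i<n desc = refl
depthOf-perform pop {i = i} {j ∷ K} i<n (K<j ∷ desc) with i ≡ᵇ j in i≡ᵇj
... | true = sym (subst (λ l → depthOf l K ≡ nothing) (sym (≡ᵇ-true⇒≡ i j i≡ᵇj)) (depthOf-fresh K<j))
... | false with depthOf i K
... | nothing = refl
... | just _ = refl
depthOf-perform skip {i = i} {K} i<n desc with depthOf i K
... | nothing = refl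
... | just _ = refl

mem-perform-false : ∀ m {n i K} → i < n → mem i K ≡ false → mem i (perform m n K) ≡ false
mem-perform-false push i<n e rewrite <⇒≡ᵇ-false i<n = e
mem-perform-false pop {K = []} i<n e = refl
mem-perform-false pop {i = i} {j ∷ K} i<n e with i ≡ᵇ j
... | false = e
mem-perform-false skip i<n e = e

mem-perform-true : ∀ m {n i K} → i < n → AllPairs _>_ K → mem i K ≡ true →
  mem i (perform m n K) ≡ not (isPop m ∧ isTop i K)
mem-perform-true push i<n desc e rewrite <⇒≡ᵇ-false i<n = e
mem-perform-true pop {i = i} {j ∷ K} i<n (K<j ∷ desc) e with i ≡ᵇ j in i≡ᵇj
... | true = subst (λ l → mem l K ≡ false) (sym (≡ᵇ-true⇒≡ i j i≡ᵇj)) (mem-fresh K<j)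
... | false = e
mem-perform-true skip i<n desc e = e

mem-perform-new : ∀ m {n K} → All (_< n) K → mem n (perform m n K) ≡ isPush m
mem-perform-new push {n} K<n rewrite ≡ᵇ-refl n = refl
mem-perform-new pop K<n = mem-fresh (All.drop⁺ 1 K<n)
mem-perform-new skip K<n = mem-fresh K<n

count-∷ʳ : ∀ ℓ w x → count ℓ (w ∷ʳ x) ≡ (if isL ℓ x then suc (count ℓ w) else count ℓ w)
count-∷ʳ ℓ [] x = refl
count-∷ʳ ℓ (y ∷ w) x rewrite count-∷ʳ ℓ w x with isL ℓ y | isL ℓ x
... | true | true = refl
... | true | false = refl
... | false | true = refl
... | false | false = refl

record StackSpec (k : Kind) (w : Word) : Set where
  field
    openers : All (λ i → i < length w × isAt w i (opening k) ≡ true) (openStack k w)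
    descending : AllPairs _>_ (openStack k w)
    walk-after : ∀ i → isAt w i (opening k) ≡ true → walk k 0 (drop (suc i) w) ≡ depthOf i (openStack k w)
    unpaired≡mem : ∀ i → (isAt w i (opening k) ∧ unpaired w i) ≡ mem i (openStack k w)
    unclosed-bound : count (opening k) w ≤ count (closing k) w + length (openStack k w)
open StackSpec

stackSpec-[] : ∀ k → StackSpec k []
stackSpec-[] k = record
  { openers = []
  ; descending = []
  ; walk-after = λ i ()
  ; unpaired≡mem = λ i → refl
  ; unclosed-bound = z≤n
  }

ParSys-after : ∀ {k w} → StackSpec k w → ∀ {i} → isAt w i (opening k) ≡ true →
  dyckFrom (opening k) (closing k) 0 (sub (ofKind k) (drop (suc i) w)) ≡ isTop i (openStack k w)
ParSys-after {k} {w} s {i} e =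
  trans (dyck-sub≡walk k 0 (drop (suc i) w))
        (trans (cong isJustZero (walk-after s i e)) (isJustZero-depthOf i (openStack k w)))

paired-last : ∀ {k w} → StackSpec k w → ∀ x {i} → isAt w i (opening k) ≡ true →
  paired (w ∷ʳ x) i (length w) ≡ isL (closing k) x ∧ isTop i (openStack k w)
paired-last {kindA} {w} s x {i} e
  rewrite <⇒<ᵇ-true (isAt⇒< w i a e)
        | isAt-∷ʳ-< w x a (isAt⇒< w i a e) | isAt-∷ʳ-< w x b (isAt⇒< w i a e)
        | e | isAt-determines w i a b e | isAt-∷ʳ-length w x a̅
        | between-∷ʳ-length w x i (isAt⇒< w i a e) | ParSys-after s e = ∨-identityʳ _
paired-last {kindB} {w} s x {i} e
  rewrite <⇒<ᵇ-true (isAt⇒< w i b e)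
        | isAt-∷ʳ-< w x a (isAt⇒< w i b e) | isAt-∷ʳ-< w x b (isAt⇒< w i b e)
        | e | isAt-determines w i b a e | isAt-∷ʳ-length w x b̅
        | between-∷ʳ-length w x i (isAt⇒< w i b e) | ParSys-after s e = refl

depthOf-push-self : ∀ k n K → depthOf n (updateStack k n (opening k) K) ≡ just 0
depthOf-push-self kindA n K rewrite ≡ᵇ-refl n = refl
depthOf-push-self kindB n K rewrite ≡ᵇ-refl n = refl

module _ {k w} (s : StackSpec k w) (x : Letter) where
  private
    n : ℕ
    n = length w
    o : Letter
    o = opening k
    K K′ : List ℕ
    K = openStack k w
    K′ = updateStack k n x K

  openers-∷ʳ : All (λ i → i < suc n × isAt (w ∷ʳ x) i o ≡ true) K′
  openers-∷ʳ = All-perform (move k x) n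
    (All.map (λ (i<n , isO) → ℕ.m≤n⇒m≤1+n i<n , trans (isAt-∷ʳ-< w x o i<n) isO) (openers s))
    (λ pushes → ℕ.n<1+n n , trans (isAt-∷ʳ-length w x o) (trans (opening-move k x) pushes))

  descending-∷ʳ : AllPairs _>_ K′
  descending-∷ʳ = descending-perform (move k x) (All.map proj₁ (openers s)) (descending s)

  walk-after-∷ʳ : ∀ i → isAt (w ∷ʳ x) i o ≡ true → walk k 0 (drop (suc i) (w ∷ʳ x)) ≡ depthOf i K′
  walk-after-∷ʳ i e with ℕ.<-cmp i n
  ... | tri< i<n _ _ = begin
      walk k 0 (drop (suc i) (w ∷ʳ x))
    ≡⟨ cong (walk k 0) (drop-++-≤ (suc i) w [ x ] i<n) ⟩
      walk k 0 (drop (suc i) w ∷ʳ x)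
    ≡⟨ walk-∷ʳ k 0 (drop (suc i) w) x ⟩
      (walk k 0 (drop (suc i) w) >>= moveDepth (move k x))
    ≡⟨ cong (_>>= moveDepth (move k x)) (walk-after s i (trans (sym (isAt-∷ʳ-< w x o i<n)) e)) ⟩
      (depthOf i K >>= moveDepth (move k x))
    ≡⟨ depthOf-perform (move k x) i<n (descending s) ⟩
      depthOf i K′
    ∎
    where open ≡-Reasoning
  ... | tri≈ _ refl _ =
    trans (cong (walk k 0) (List.drop-all (suc n) (w ∷ʳ x) (ℕ.≤-reflexive (length-∷ʳ w x))))
          (sym (subst (λ y → depthOf n (updateStack k n y K) ≡ just 0) (sym x≡o) (depthOf-push-self k n K)))
    where
    x≡o : x ≡ o
    x≡o = isL⇒≡ o x (trans (sym (isAt-∷ʳ-length w x o)) e)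
  ... | tri> _ _ n<i with trans (sym e) (isAt-≥ (w ∷ʳ x) o (subst (_≤ i) (sym (length-∷ʳ w x)) n<i))
  ... | ()

  unpaired≡mem-∷ʳ : ∀ i → (isAt (w ∷ʳ x) i o ∧ unpaired (w ∷ʳ x) i) ≡ mem i K′
  unpaired≡mem-∷ʳ i with ℕ.<-cmp i n
  ... | tri< i<n _ _
    rewrite isAt-∷ʳ-< w x o i<n | unpaired-∷ʳ w x i
          | sym (∧-assoc (isAt w i o) (unpaired w i) (not (paired (w ∷ʳ x) i n)))
          | unpaired≡mem s i
    with mem i K in i∈K
  ... | false = sym (mem-perform-false (move k x) i<n i∈K)
  ... | true rewrite paired-last s x (proj₂ (All-mem i (openers s) i∈K)) | closing-move k x =
    sym (mem-perform-true (move k x) i<n (descending s) i∈K)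
  unpaired≡mem-∷ʳ i | tri≈ _ refl _
    rewrite isAt-∷ʳ-length w x o | unpaired-∷ʳ-length w x
          | mem-perform-new (move k x) (All.map proj₁ (openers s)) = trans (∧-identityʳ _) (opening-move k x)
  unpaired≡mem-∷ʳ i | tri> _ _ n<i
    rewrite isAt-≥ (w ∷ʳ x) o (subst (_≤ i) (sym (length-∷ʳ w x)) n<i) =
    sym (mem-fresh (All.map (λ (j<1+n , _) → ℕ.≤-trans j<1+n n<i) openers-∷ʳ))

  unclosed-bound-∷ʳ : count o (w ∷ʳ x) ≤ count (closing k) (w ∷ʳ x) + length K′
  unclosed-bound-∷ʳ
    rewrite count-∷ʳ o w x | count-∷ʳ (closing k) w x | opening-move k x | closing-move k x =
    bound-perform (move k x) (unclosed-bound s)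
    where
    bound-perform : ∀ m {co cc L} → co ≤ cc + length L →
      (if isPush m then suc co else co) ≤ (if isPop m then suc cc else cc) + length (perform m n L)
    bound-perform push {cc = cc} {L} h rewrite ℕ.+-suc cc (length L) = s≤s h
    bound-perform pop {L = []} h = ℕ.m≤n⇒m≤1+n h
    bound-perform pop {cc = cc} {_ ∷ L} h rewrite ℕ.+-suc cc (length L) = h
    bound-perform skip h = h

stackSpec-∷ʳ : ∀ {k w} x → StackSpec k w → StackSpec k (w ∷ʳ x)
stackSpec-∷ʳ {k} {w} x s = record
  { openers = subst₂ (λ m K → All (λ i → i < m × isAt (w ∷ʳ x) i (opening k) ≡ true) K)
                     (sym (length-∷ʳ w x)) (sym K≡) (openers-∷ʳ s x)
  ; descending = subst (AllPairs _>_) (sym K≡) (descending-∷ʳ s x)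
  ; walk-after = λ i e → trans (walk-after-∷ʳ s x i e) (cong (depthOf i) (sym K≡))
  ; unpaired≡mem = λ i → trans (unpaired≡mem-∷ʳ s x i) (cong (mem i) (sym K≡))
  ; unclosed-bound = subst (λ K → count (opening k) (w ∷ʳ x) ≤ count (closing k) (w ∷ʳ x) + length K)
                           (sym K≡) (unclosed-bound-∷ʳ s x)
  }
  where
  K≡ : openStack k (w ∷ʳ x) ≡ updateStack k (length w) x (openStack k w)
  K≡ = openStack-∷ʳ k w x

stackSpec : ∀ k w → StackSpec k w
stackSpec k w = go (reverseView w)
  where
  go : ∀ {w} → Reverse w → StackSpec k w
  go [] = stackSpec-[] k
  go (_ ∶ r ∶ʳ x) = stackSpec-∷ʳ x (go r)

tour : Word → TourState
tour w = tourFrom 0 w (st ((root , []) ∷ []) [])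

tourFrom-∷ʳ : ∀ i xs x σ₀ → tourFrom i (xs ∷ʳ x) σ₀ ≡ step (i + length xs) x (tourFrom i xs σ₀)
tourFrom-∷ʳ i [] x σ₀ = cong (λ j → step j x σ₀) (sym (ℕ.+-identityʳ i))
tourFrom-∷ʳ i (y ∷ xs) x σ₀ =
  trans (tourFrom-∷ʳ (suc i) xs x (step i y σ₀))
        (cong (λ j → step j x (tourFrom (suc i) xs (step i y σ₀))) (sym (ℕ.+-suc i (length xs))))

tour-∷ʳ : ∀ w x → tour (w ∷ʳ x) ≡ step (length w) x (tour w)
tour-∷ʳ w x = tourFrom-∷ʳ 0 w x _

-- With G the open a-stack after n letters: a half-edge that survives the deletion of active tails.
Kept : List ℕ → ℕ → HE → Set
Kept G n (aT i) = i < n × mem i G ≡ false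
Kept G n _ = ⊤

AllKept : List ℕ → ℕ → List HE → Set
AllKept G n = All (Kept G n)

data PathVertex (G : List ℕ) (n : ℕ) : Maybe ℕ → List HE → Set where
  top : ∀ {inc} → AllKept G n inc → PathVertex G n nothing inc
  below : ∀ {c inc} → AllKept G n inc → PathVertex G n (just c) (aT c ∷ inc)

-- The stack of the tour is the path from the current vertex down to the root-vertex along the
-- open edges listed in K; below a vertex, the latest incidence is the tail of the open edge leading up to it.
data OpenPath (G : List ℕ) (n : ℕ) : Maybe ℕ → List ℕ → List Vertex → Set where
  rootPath : ∀ {mc inc} → PathVertex G n mc inc → OpenPath G n mc [] ((root , inc) ∷ [])
  _◂_ : ∀ {mc c K inc s} → PathVertex G n mc inc → OpenPath G n (just c) K s →
        OpenPath G n mc (c ∷ K) ((aH c , inc) ∷ s)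

record OpenWithin (n : ℕ) (G′ G : List ℕ) : Set where
  constructor openWithin
  field stillOpen : ∀ i → i < n → mem i G′ ≡ true → mem i G ≡ true

module _ {n n′ G G′} (G′⊆G : OpenWithin n G′ G) (n≤n′ : n ≤ n′) where

  Kept-mono : ∀ e → Kept G n e → Kept G′ n′ e
  Kept-mono (aT i) (i<n , i∉G) = ℕ.<-≤-trans i<n n≤n′ , contraposeᵇ (OpenWithin.stillOpen G′⊆G i i<n) i∉G
    where
    contraposeᵇ : ∀ {p q} → (p ≡ true → q ≡ true) → q ≡ false → p ≡ false
    contraposeᵇ {false} _ _ = refl
    contraposeᵇ {true} f q≡false = trans (sym (f refl)) q≡false
  Kept-mono root _ = _
  Kept-mono (aH _) _ = _
  Kept-mono (bH _) _ = _
  Kept-mono (bT _) _ = _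

  AllKept-mono : ∀ {inc} → AllKept G n inc → AllKept G′ n′ inc
  AllKept-mono = All.map (Kept-mono _)

  PathVertex-mono : ∀ {mc inc} → PathVertex G n mc inc → PathVertex G′ n′ mc inc
  PathVertex-mono (top k) = top (AllKept-mono k)
  PathVertex-mono (below k) = below (AllKept-mono k)

  OpenPath-mono : ∀ {mc K s} → OpenPath G n mc K s → OpenPath G′ n′ mc K s
  OpenPath-mono (rootPath pv) = rootPath (PathVertex-mono pv)
  OpenPath-mono (pv ◂ p) = PathVertex-mono pv ◂ OpenPath-mono p

  closedKept-mono : ∀ {d : List Vertex} →
    All (λ V → AllKept G n (proj₂ V)) d → All (λ V → AllKept G′ n′ (proj₂ V)) d
  closedKept-mono = All.map (λ {V} → AllKept-mono {proj₂ V})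

addAtTop : ∀ {G n K h inc s} e → Kept G n e → OpenPath G n nothing K ((h , inc) ∷ s) →
  OpenPath G n nothing K ((h , e ∷ inc) ∷ s)
addAtTop e ke (rootPath (top k)) = rootPath (top (ke ∷ k))
addAtTop e ke (top k ◂ p) = top (ke ∷ k) ◂ p

openAtTop : ∀ {G n K h inc s} c → OpenPath G n nothing K ((h , inc) ∷ s) →
  OpenPath G n (just c) K ((h , aT c ∷ inc) ∷ s)
openAtTop c (rootPath (top k)) = rootPath (below k)
openAtTop c (top k ◂ p) = below k ◂ p

closeAtTop : ∀ {G n c K s} → c < n → mem c G ≡ false → OpenPath G n (just c) K s → OpenPath G n nothing K s
closeAtTop c<n c∉G (rootPath (below k)) = rootPath (top ((c<n , c∉G) ∷ k))
closeAtTop c<n c∉G (below k ◂ p) = top ((c<n , c∉G) ∷ k) ◂ p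

TourInvariant : List ℕ → ℕ → TourState → Set
TourInvariant G n σ =
  OpenPath G n nothing G (TourState.stack σ) × All (λ V → AllKept G n (proj₂ V)) (TourState.done σ)

tourInvariant-pop : ∀ {c K n inc s d} → AllKept (c ∷ K) n inc → OpenPath (c ∷ K) n (just c) K s →
  All (λ V → AllKept (c ∷ K) n (proj₂ V)) d → c < n → All (_< c) K →
  TourInvariant K (suc n) (st s (close (aH c , inc) ∷ d))
tourInvariant-pop {c} {K} {n} k p closed c<n K<c =
  closeAtTop (ℕ.m≤n⇒m≤1+n c<n) (mem-fresh K<c) (OpenPath-mono popped (ℕ.n≤1+n n) p) ,
  All-reverse (AllKept-mono popped (ℕ.n≤1+n n) k) ∷ closedKept-mono popped (ℕ.n≤1+n n) closed
  where
  popped : OpenWithin n K (c ∷ K)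
  popped = openWithin λ i _ e → mem-there i c K e

tourInvariant-add : ∀ {G n h inc s d} e → Kept G (suc n) e →
  TourInvariant G n (st ((h , inc) ∷ s) d) → TourInvariant G (suc n) (st ((h , e ∷ inc) ∷ s) d)
tourInvariant-add {G} {n} e ke (p , closed) =
  addAtTop e ke (OpenPath-mono unchanged (ℕ.n≤1+n n) p) , closedKept-mono unchanged (ℕ.n≤1+n n) closed
  where
  unchanged : OpenWithin n G G
  unchanged = openWithin λ _ _ e → e

tourInvariant-step : ∀ {G n σ} x → AllPairs _>_ G → All (_< n) G → (x ≡ a̅ → G ≢ []) →
  TourInvariant G n σ → TourInvariant (updateStack kindA n x G) (suc n) (step n x σ)
tourInvariant-step {G} {n} {st (_ ∷ _) _} a _ _ _ (p , closed) =
  top [] ◂ openAtTop n (OpenPath-mono pushed (ℕ.n≤1+n n) p) , closedKept-mono pushed (ℕ.n≤1+n n) closed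
  where
  pushed : OpenWithin n (n ∷ G) G
  pushed = openWithin λ i i<n e → trans (sym (cong (_∨ mem i G) (<⇒≡ᵇ-false i<n))) e
tourInvariant-step {n = n} {st (_ ∷ _) _} b _ _ _ inv = tourInvariant-add (bH n) _ inv
tourInvariant-step {n = n} {st (_ ∷ _) _} b̅ _ _ _ inv = tourInvariant-add (bT n) _ inv
tourInvariant-step {[]} a̅ _ _ nonempty _ = ⊥-elim (nonempty refl refl)
tourInvariant-step {c ∷ K} {σ = st _ _} a̅ (K<c ∷ _) (c<n ∷ _) _ (top k ◂ p@(rootPath _) , closed) =
  tourInvariant-pop k p closed c<n K<c
tourInvariant-step {c ∷ K} {σ = st _ _} a̅ (K<c ∷ _) (c<n ∷ _) _ (top k ◂ p@(_ ◂ _) , closed) =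
  tourInvariant-pop k p closed c<n K<c

TourSpec : Word → Set
TourSpec w = TourInvariant (openStack kindA w) (length w) (tour w)

tourSpec-[] : TourSpec []
tourSpec-[] = rootPath (top []) , []

tourSpec-∷ʳ : ∀ {w} x → StackSpec kindA w → (x ≡ a̅ → openStack kindA w ≢ []) → TourSpec w → TourSpec (w ∷ʳ x)
tourSpec-∷ʳ {w} x sA nonempty t rewrite openStack-∷ʳ kindA w x | length-∷ʳ w x | tour-∷ʳ w x =
  tourInvariant-step x (descending sA) (All.map proj₁ (openers sA)) nonempty t

closeBelow : Vertex → Vertex
closeBelow (h , inc) = (h , reverse (drop 1 inc))

forestBelow : List Vertex → List Vertex → List Vertex
forestBelow [] d = concatMap explode d
forestBelow (V ∷ s) d = explode (closeBelow V) ++ forestBelow s d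

-- F_w read off a tour state: the latest incidence of each vertex strictly below the current one is
-- the tail of an active edge, hence deleted.
forestOf : TourState → List Vertex
forestOf (st [] d) = concatMap explode d
forestOf (st (V ∷ s) d) = explode (close V) ++ forestBelow s d

deleteActive-∷ʳ-dropped : ∀ w h xs e → keep w e ≡ false →
  proj₂ (deleteActive w (h , xs ∷ʳ e)) ≡ proj₂ (deleteActive w (h , xs))
deleteActive-∷ʳ-dropped w h [] e dropped rewrite dropped = refl
deleteActive-∷ʳ-dropped w h (x ∷ xs) e dropped with keep w x
... | true = cong (x ∷_) (deleteActive-∷ʳ-dropped w h xs e dropped)
... | false = deleteActive-∷ʳ-dropped w h xs e dropped

module _ {w G} (active≡mem : ∀ i → active w i ≡ mem i G) where

  keep-Kept : ∀ {n} e → Kept G n e → keep w e ≡ true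
  keep-Kept (aT i) (_ , i∉G) rewrite active≡mem i | i∉G = refl
  keep-Kept root _ = refl
  keep-Kept (aH _) _ = refl
  keep-Kept (bH _) _ = refl
  keep-Kept (bT _) _ = refl

  deleteActive-kept : ∀ {n} h xs → AllKept G n xs → proj₂ (deleteActive w (h , xs)) ≡ xs
  deleteActive-kept h [] [] = refl
  deleteActive-kept h (x ∷ xs) (kx ∷ kxs) rewrite keep-Kept x kx = cong (x ∷_) (deleteActive-kept h xs kxs)

  deleteActive-close-top : ∀ {n} h inc → AllKept G n inc → deleteActive w (close (h , inc)) ≡ close (h , inc)
  deleteActive-close-top h inc k = cong (h ,_) (deleteActive-kept h (reverse inc) (All-reverse k))

  deleteActive-close-below : ∀ {n} h c inc → mem c G ≡ true → AllKept G n inc →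
    deleteActive w (close (h , aT c ∷ inc)) ≡ closeBelow (h , aT c ∷ inc)
  deleteActive-close-below h c inc c∈G k =
    trans (cong (λ z → deleteActive w (h , z)) (List.unfold-reverse (aT c) inc))
    (cong (h ,_) (trans (deleteActive-∷ʳ-dropped w h (reverse inc) (aT c) dropped)
                        (deleteActive-kept h (reverse inc) (All-reverse k))))
    where
    dropped : keep w (aT c) ≡ false
    dropped rewrite active≡mem c | c∈G = refl

  forest-closed : ∀ {n} d → All (λ V → AllKept G n (proj₂ V)) d →
    concatMap (λ V → explode (deleteActive w V)) d ≡ concatMap explode d
  forest-closed [] [] = refl
  forest-closed ((h , inc) ∷ d) (k ∷ ks) =
    cong₂ _++_ (cong (λ z → explode (h , z)) (deleteActive-kept h inc k)) (forest-closed d ks)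

  forestBelow-path : ∀ {n c K s} d → OpenPath G n (just c) K s → mem c G ≡ true →
    (∀ i → mem i K ≡ true → mem i G ≡ true) →
    concatMap (λ V → explode (deleteActive w V)) d ≡ concatMap explode d →
    concatMap (λ V → explode (deleteActive w V)) (map close s ++ d) ≡ forestBelow s d
  forestBelow-path d (rootPath (below {inc = inc} k)) c∈G _ closedOK =
    cong₂ _++_ (cong explode (deleteActive-close-below root _ inc c∈G k)) closedOK
  forestBelow-path d (_◂_ {c = c′} {K = K′} (below {inc = inc} k) p) c∈G K⊆G closedOK =
    cong₂ _++_ (cong explode (deleteActive-close-below (aH c′) _ inc c∈G k))
      (forestBelow-path d p (K⊆G c′ (mem-here c′ K′)) (λ i e → K⊆G i (mem-there i c′ K′ e)) closedOK)

  forestOf-path : ∀ {n s} d → OpenPath G n nothing G s → All (λ V → AllKept G n (proj₂ V)) d →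
    concatMap (λ V → explode (deleteActive w V)) (map close s ++ d) ≡ forestOf (st s d)
  forestOf-path d (rootPath (top {inc = inc} k)) closed =
    cong₂ _++_ (cong explode (deleteActive-close-top root inc k)) (forest-closed d closed)
  forestOf-path d (_◂_ {c = c} {K = K} (top {inc = inc} k) p) closed =
    cong₂ _++_ (cong explode (deleteActive-close-top (aH c) inc k))
      (forestBelow-path d p (mem-here c K) (λ i e → mem-there i c K e) (forest-closed d closed))

forest≡forestOf : ∀ w → StackSpec kindA w → TourSpec w → forest w ≡ forestOf (tour w)
forest≡forestOf w sA (p , closed) = forestOf-path (unpaired≡mem sA) (TourState.done (tour w)) p closed

splitAtHeads : List HE → List HE → List Vertex × List HE
splitAtHeads acc [] = ([] , acc)
splitAtHeads acc (x ∷ xs) =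
  if isHead x then ((x , reverse acc) ∷ proj₁ (splitAtHeads [] xs) , proj₂ (splitAtHeads [] xs))
  else splitAtHeads (x ∷ acc) xs

explodeGo-splitAtHeads : ∀ h acc xs →
  explodeGo h acc xs ≡ proj₁ (splitAtHeads acc xs) ++ (h , reverse (proj₂ (splitAtHeads acc xs))) ∷ []
explodeGo-splitAtHeads h acc [] = refl
explodeGo-splitAtHeads h acc (x ∷ xs) with isHead x
... | true = cong ((x , reverse acc) ∷_) (explodeGo-splitAtHeads h [] xs)
... | false = explodeGo-splitAtHeads h (x ∷ acc) xs

splitAtHeads-∷ʳ-tail : ∀ acc xs y → isHead y ≡ false →
  splitAtHeads acc (xs ∷ʳ y) ≡ (proj₁ (splitAtHeads acc xs) , y ∷ proj₂ (splitAtHeads acc xs))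
splitAtHeads-∷ʳ-tail acc [] y tl rewrite tl = refl
splitAtHeads-∷ʳ-tail acc (x ∷ xs) y tl with isHead x
... | true rewrite splitAtHeads-∷ʳ-tail [] xs y tl = refl
... | false = splitAtHeads-∷ʳ-tail (x ∷ acc) xs y tl

splitAtHeads-∷ʳ-head : ∀ acc xs y → isHead y ≡ true →
  splitAtHeads acc (xs ∷ʳ y) ≡ (proj₁ (splitAtHeads acc xs) ∷ʳ (y , reverse (proj₂ (splitAtHeads acc xs))) , [])
splitAtHeads-∷ʳ-head acc [] y hd rewrite hd = refl
splitAtHeads-∷ʳ-head acc (x ∷ xs) y hd with isHead x
... | true rewrite splitAtHeads-∷ʳ-head [] xs y hd = refl
... | false = splitAtHeads-∷ʳ-head (x ∷ acc) xs y hd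

-- Exploding a vertex whose incidences were recorded latest-first gives the vertices of its other heads,
-- then its own head with the tails met after the last of those heads.
pieces : List HE → List Vertex
pieces inc = proj₁ (splitAtHeads [] (reverse inc))

trailingTails : List HE → List HE
trailingTails inc = reverse (proj₂ (splitAtHeads [] (reverse inc)))

explode-close : ∀ h inc → explode (close (h , inc)) ≡ pieces inc ++ (h , trailingTails inc) ∷ []
explode-close h inc = explodeGo-splitAtHeads h [] (reverse inc)

explode-close-tail : ∀ h y inc → isHead y ≡ false →
  explode (close (h , y ∷ inc)) ≡ pieces inc ++ (h , trailingTails inc ∷ʳ y) ∷ []
explode-close-tail h y inc tl =
  trans (cong (λ z → explode (h , z)) (List.unfold-reverse y inc))
  (trans (explodeGo-splitAtHeads h [] (reverse inc ∷ʳ y))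
  (trans (cong (λ r → proj₁ r ++ (h , reverse (proj₂ r)) ∷ []) (splitAtHeads-∷ʳ-tail [] (reverse inc) y tl))
         (cong (λ z → pieces inc ++ (h , z) ∷ []) (List.unfold-reverse y (proj₂ (splitAtHeads [] (reverse inc)))))))

explode-close-head : ∀ h y inc → isHead y ≡ true →
  explode (close (h , y ∷ inc)) ≡ pieces inc ++ (y , trailingTails inc) ∷ (h , []) ∷ []
explode-close-head h y inc hd =
  trans (cong (λ z → explode (h , z)) (List.unfold-reverse y inc))
  (trans (explodeGo-splitAtHeads h [] (reverse inc ∷ʳ y))
  (trans (cong (λ r → proj₁ r ++ (h , reverse (proj₂ r)) ∷ []) (splitAtHeads-∷ʳ-head [] (reverse inc) y hd))
         (List.++-assoc (pieces inc) ((y , trailingTails inc) ∷ []) ((h , []) ∷ []))))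

forestBelow-∷-closed : ∀ s V d → forestBelow s (V ∷ d) ↭ explode V ++ forestBelow s d
forestBelow-∷-closed [] V d = ↭-refl
forestBelow-∷-closed (W ∷ s) V d =
  ↭-trans (Perm.++⁺ˡ (explode (closeBelow W)) (forestBelow-∷-closed s V d))
          (Perm.shifts (explode (closeBelow W)) (explode V))

treesV : List Tree → TreeSeq
treesV = concatMap (λ t → tr t ∷ v ∷ [])

treesU : List Tree → TreeSeq
treesU = concatMap (λ t → tr t ∷ u ∷ [])

-- The tree-sequence u t₁ u ⋯ u t_k u t′_l v ⋯ v t′₁ v, from the two lists of trees most recent first
-- (t_k, …, t₁ and t′_l, …, t′₁).
stackSeq : List Tree → List Tree → TreeSeq
stackSeq D R = reverse (treesU D) ++ u ∷ treesV R

treesV-no-u : ∀ R → All (_≢ u) (treesV R)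
treesV-no-u [] = []
treesV-no-u (_ ∷ R) = (λ ()) ∷ (λ ()) ∷ treesV-no-u R

treesU-no-v : ∀ D → All (_≢ v) (treesU D)
treesU-no-v [] = []
treesU-no-v (_ ∷ D) = (λ ()) ∷ (λ ()) ∷ treesU-no-v D

firstV-skip : ∀ X R → All (_≢ v) X → firstV (X ++ v ∷ R) ≡ just (X ++ u ∷ tr τ ∷ v ∷ R)
firstV-skip [] R [] = refl
firstV-skip (u ∷ X) R (_ ∷ ok) rewrite firstV-skip X R ok = refl
firstV-skip (tr _ ∷ X) R (_ ∷ ok) rewrite firstV-skip X R ok = refl
firstV-skip (v ∷ X) R (v≢v ∷ _) = ⊥-elim (v≢v refl)

firstURev-skip : ∀ X R → All (_≢ u) X → firstURev (X ++ u ∷ R) ≡ just (X ++ v ∷ tr τ ∷ u ∷ R)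
firstURev-skip [] R [] = refl
firstURev-skip (v ∷ X) R (_ ∷ ok) rewrite firstURev-skip X R ok = refl
firstURev-skip (tr _ ∷ X) R (_ ∷ ok) rewrite firstURev-skip X R ok = refl
firstURev-skip (u ∷ X) R (u≢u ∷ _) = ⊥-elim (u≢u refl)

aroundFirstV-skip : ∀ X T₁ T₂ Z → All (_≢ v) X →
  aroundFirstV (X ++ tr T₁ ∷ v ∷ tr T₂ ∷ Z) ≡ just (X ++ tr (σ T₁ T₂) ∷ Z)
aroundFirstV-skip [] T₁ T₂ Z [] = refl
aroundFirstV-skip (u ∷ X) T₁ T₂ Z (_ ∷ ok) rewrite aroundFirstV-skip X T₁ T₂ Z ok = refl
aroundFirstV-skip (tr _ ∷ []) T₁ T₂ Z (_ ∷ ok) rewrite aroundFirstV-skip [] T₁ T₂ Z ok = refl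
aroundFirstV-skip (tr _ ∷ u ∷ X) T₁ T₂ Z (_ ∷ ok) rewrite aroundFirstV-skip (u ∷ X) T₁ T₂ Z ok = refl
aroundFirstV-skip (tr _ ∷ tr t ∷ X) T₁ T₂ Z (_ ∷ ok) rewrite aroundFirstV-skip (tr t ∷ X) T₁ T₂ Z ok = refl
aroundFirstV-skip (tr _ ∷ v ∷ X) T₁ T₂ Z (_ ∷ v≢v ∷ _) = ⊥-elim (v≢v refl)
aroundFirstV-skip (v ∷ X) T₁ T₂ Z (v≢v ∷ _) = ⊥-elim (v≢v refl)

aroundFirstURev-skip : ∀ X T₁ T₂ Z → All (_≢ u) X →
  aroundFirstURev (X ++ tr T₂ ∷ u ∷ tr T₁ ∷ Z) ≡ just (X ++ tr (σ T₁ T₂) ∷ Z)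
aroundFirstURev-skip [] T₁ T₂ Z [] = refl
aroundFirstURev-skip (v ∷ X) T₁ T₂ Z (_ ∷ ok) rewrite aroundFirstURev-skip X T₁ T₂ Z ok = refl
aroundFirstURev-skip (tr _ ∷ []) T₁ T₂ Z (_ ∷ ok) rewrite aroundFirstURev-skip [] T₁ T₂ Z ok = refl
aroundFirstURev-skip (tr _ ∷ v ∷ X) T₁ T₂ Z (_ ∷ ok) rewrite aroundFirstURev-skip (v ∷ X) T₁ T₂ Z ok = refl
aroundFirstURev-skip (tr _ ∷ tr t ∷ X) T₁ T₂ Z (_ ∷ ok) rewrite aroundFirstURev-skip (tr t ∷ X) T₁ T₂ Z ok = refl
aroundFirstURev-skip (tr _ ∷ u ∷ X) T₁ T₂ Z (_ ∷ u≢u ∷ _) = ⊥-elim (u≢u refl)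
aroundFirstURev-skip (u ∷ X) T₁ T₂ Z (u≢u ∷ _) = ⊥-elim (u≢u refl)

reverse-∷-∷ : ∀ (x y : Sym) C → reverse (x ∷ y ∷ C) ≡ reverse C ++ y ∷ x ∷ []
reverse-∷-∷ x y C =
  trans (List.unfold-reverse x (y ∷ C))
        (trans (cong (_∷ʳ x) (List.unfold-reverse y C)) (List.++-assoc (reverse C) [ y ] [ x ]))

reverse-stackSeq : ∀ D R → reverse (stackSeq D R) ≡ reverse (treesV R) ++ u ∷ treesU D
reverse-stackSeq D R = begin
    reverse (reverse (treesU D) ++ u ∷ treesV R)
  ≡⟨ List.reverse-++ (reverse (treesU D)) (u ∷ treesV R) ⟩
    reverse (u ∷ treesV R) ++ reverse (reverse (treesU D))
  ≡⟨ cong₂ _++_ (List.unfold-reverse u (treesV R)) (List.reverse-involutive (treesU D)) ⟩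
    (reverse (treesV R) ∷ʳ u) ++ treesU D
  ≡⟨ List.++-assoc (reverse (treesV R)) [ u ] (treesU D) ⟩
    reverse (treesV R) ++ u ∷ treesU D
  ∎
  where open ≡-Reasoning

viaReverse-just : ∀ f S S′ → f (reverse S) ≡ just (reverse S′) → viaReverse f S ≡ just S′
viaReverse-just f S S′ e rewrite e = cong just (List.reverse-involutive S′)

λstep-a : ∀ D R → λstep a (stackSeq D R) ≡ just (stackSeq D (τ ∷ R))
λstep-a D R = viaReverse-just firstURev (stackSeq D R) (stackSeq D (τ ∷ R)) (begin
    firstURev (reverse (stackSeq D R))
  ≡⟨ cong firstURev (reverse-stackSeq D R) ⟩
    firstURev (reverse (treesV R) ++ u ∷ treesU D)
  ≡⟨ firstURev-skip (reverse (treesV R)) (treesU D) (All-reverse (treesV-no-u R)) ⟩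
    just (reverse (treesV R) ++ v ∷ tr τ ∷ u ∷ treesU D)
  ≡⟨ cong just (sym (List.++-assoc (reverse (treesV R)) (v ∷ tr τ ∷ []) (u ∷ treesU D))) ⟩
    just ((reverse (treesV R) ++ v ∷ tr τ ∷ []) ++ u ∷ treesU D)
  ≡⟨ cong (λ z → just (z ++ u ∷ treesU D)) (sym (reverse-∷-∷ (tr τ) v (treesV R))) ⟩
    just (reverse (treesV (τ ∷ R)) ++ u ∷ treesU D)
  ≡⟨ cong just (sym (reverse-stackSeq D (τ ∷ R))) ⟩
    just (reverse (stackSeq D (τ ∷ R)))
  ∎)
  where open ≡-Reasoning

λstep-b : ∀ D T R → λstep b (stackSeq D (T ∷ R)) ≡ just (stackSeq (T ∷ D) (τ ∷ R))
λstep-b D T R = begin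
    firstV (reverse (treesU D) ++ u ∷ tr T ∷ v ∷ treesV R)
  ≡⟨ cong firstV (sym (List.++-assoc (reverse (treesU D)) (u ∷ tr T ∷ []) (v ∷ treesV R))) ⟩
    firstV (X ++ v ∷ treesV R)
  ≡⟨ firstV-skip X (treesV R) (All.++⁺ (All-reverse (treesU-no-v D)) ((λ ()) ∷ (λ ()) ∷ [])) ⟩
    just (X ++ u ∷ tr τ ∷ v ∷ treesV R)
  ≡⟨ cong (λ z → just (z ++ u ∷ tr τ ∷ v ∷ treesV R)) (sym (reverse-∷-∷ (tr T) u (treesU D))) ⟩
    just (stackSeq (T ∷ D) (τ ∷ R))
  ∎
  where
  X : TreeSeq
  X = reverse (treesU D) ++ u ∷ tr T ∷ []
  open ≡-Reasoning

λstep-a̅ : ∀ D T₁ T₂ R → λstep a̅ (stackSeq D (T₁ ∷ T₂ ∷ R)) ≡ just (stackSeq D (σ T₁ T₂ ∷ R))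
λstep-a̅ D T₁ T₂ R = begin
    aroundFirstV (reverse (treesU D) ++ u ∷ tr T₁ ∷ v ∷ tr T₂ ∷ v ∷ treesV R)
  ≡⟨ cong aroundFirstV (sym (List.++-assoc (reverse (treesU D)) [ u ] (tr T₁ ∷ v ∷ tr T₂ ∷ v ∷ treesV R))) ⟩
    aroundFirstV (X ++ tr T₁ ∷ v ∷ tr T₂ ∷ v ∷ treesV R)
  ≡⟨ aroundFirstV-skip X T₁ T₂ (v ∷ treesV R) (All.++⁺ (All-reverse (treesU-no-v D)) ((λ ()) ∷ [])) ⟩
    just (X ++ tr (σ T₁ T₂) ∷ v ∷ treesV R)
  ≡⟨ cong just (List.++-assoc (reverse (treesU D)) [ u ] (tr (σ T₁ T₂) ∷ v ∷ treesV R)) ⟩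
    just (stackSeq D (σ T₁ T₂ ∷ R))
  ∎
  where
  X : TreeSeq
  X = reverse (treesU D) ∷ʳ u
  open ≡-Reasoning

λstep-b̅ : ∀ T₁ D T₂ R → λstep b̅ (stackSeq (T₁ ∷ D) (T₂ ∷ R)) ≡ just (stackSeq D (σ T₁ T₂ ∷ R))
λstep-b̅ T₁ D T₂ R = viaReverse-just aroundFirstURev (stackSeq (T₁ ∷ D) (T₂ ∷ R)) (stackSeq D (σ T₁ T₂ ∷ R)) (begin
    aroundFirstURev (reverse (stackSeq (T₁ ∷ D) (T₂ ∷ R)))
  ≡⟨ cong aroundFirstURev (reverse-stackSeq (T₁ ∷ D) (T₂ ∷ R)) ⟩
    aroundFirstURev (reverse (tr T₂ ∷ v ∷ treesV R) ++ u ∷ tr T₁ ∷ u ∷ treesU D)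
  ≡⟨ cong (λ z → aroundFirstURev (z ++ u ∷ tr T₁ ∷ u ∷ treesU D)) (reverse-∷-∷ (tr T₂) v (treesV R)) ⟩
    aroundFirstURev ((reverse (treesV R) ++ v ∷ tr T₂ ∷ []) ++ u ∷ tr T₁ ∷ u ∷ treesU D)
  ≡⟨ cong aroundFirstURev (reassoc (tr T₂) (u ∷ tr T₁ ∷ u ∷ treesU D)) ⟩
    aroundFirstURev (X ++ tr T₂ ∷ u ∷ tr T₁ ∷ u ∷ treesU D)
  ≡⟨ aroundFirstURev-skip X T₁ T₂ (u ∷ treesU D) (All.++⁺ (All-reverse (treesV-no-u R)) ((λ ()) ∷ [])) ⟩
    just (X ++ tr (σ T₁ T₂) ∷ u ∷ treesU D)
  ≡⟨ cong just (sym (reassoc (tr (σ T₁ T₂)) (u ∷ treesU D))) ⟩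
    just ((reverse (treesV R) ++ v ∷ tr (σ T₁ T₂) ∷ []) ++ u ∷ treesU D)
  ≡⟨ cong (λ z → just (z ++ u ∷ treesU D)) (sym (reverse-∷-∷ (tr (σ T₁ T₂)) v (treesV R))) ⟩
    just (reverse (treesV (σ T₁ T₂ ∷ R)) ++ u ∷ treesU D)
  ≡⟨ cong just (sym (reverse-stackSeq D (σ T₁ T₂ ∷ R))) ⟩
    just (reverse (stackSeq D (σ T₁ T₂ ∷ R)))
  ∎)
  where
  X : TreeSeq
  X = reverse (treesV R) ∷ʳ v
  reassoc : ∀ y Z → (reverse (treesV R) ++ v ∷ y ∷ []) ++ Z ≡ X ++ y ∷ Z
  reassoc y Z = trans (List.++-assoc (reverse (treesV R)) (v ∷ y ∷ []) Z)
                      (sym (List.++-assoc (reverse (treesV R)) [ v ] (y ∷ Z)))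
  open ≡-Reasoning

λ₀From-∷ʳ : ∀ s w x → λ₀From s (w ∷ʳ x) ≡ (λ₀From s w >>= λstep x)
λ₀From-∷ʳ s [] x with λstep x s
... | nothing = refl
... | just _ = refl
λ₀From-∷ʳ s (y ∷ w) x with λstep y s
... | nothing = refl
... | just s′ = λ₀From-∷ʳ s′ w x

λ₀-∷ʳ : ∀ w x {S S′} → λ₀ w ≡ just S → λstep x S ≡ just S′ → λ₀ (w ∷ʳ x) ≡ just S′
λ₀-∷ʳ w x e₀ eₓ = trans (λ₀From-∷ʳ (u ∷ tr τ ∷ v ∷ []) w x) (trans (cong (_>>= λstep x) e₀) eₓ)

stackSeq≡expectedSeq : ∀ D R → stackSeq D R ≡ expectedSeq (reverse D) (reverse R)
stackSeq≡expectedSeq D R =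
  cong₂ (λ X Y → X ++ u ∷ treesV Y) (reverse-treesU D) (sym (List.reverse-involutive R))
  where
  reverse-treesU : ∀ D → reverse (treesU D) ≡ concatMap (λ t → u ∷ tr t ∷ []) (reverse D)
  reverse-treesU [] = refl
  reverse-treesU (T ∷ D) = begin
      reverse (tr T ∷ u ∷ treesU D)
    ≡⟨ reverse-∷-∷ (tr T) u (treesU D) ⟩
      reverse (treesU D) ++ u ∷ tr T ∷ []
    ≡⟨ cong (_++ u ∷ tr T ∷ []) (reverse-treesU D) ⟩
      concatMap (λ t → u ∷ tr t ∷ []) (reverse D) ++ concatMap (λ t → u ∷ tr t ∷ []) [ T ]
    ≡⟨ sym (List.concatMap-++ (λ t → u ∷ tr t ∷ []) (reverse D) [ T ]) ⟩
      concatMap (λ t → u ∷ tr t ∷ []) (reverse D ∷ʳ T)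
    ≡⟨ cong (concatMap (λ t → u ∷ tr t ∷ [])) (sym (List.unfold-reverse T D)) ⟩
      concatMap (λ t → u ∷ tr t ∷ []) (reverse (T ∷ D))
    ∎
    where open ≡-Reasoning

Unique-resp-↭ : ∀ {xs ys : List HE} → xs ↭ ys → Unique xs → Unique ys
Unique-resp-↭ p = PermSetoid.Unique-resp-↭ (setoid HE) (↭⇒↭ₛ p)

unique-middle : ∀ xs {y : HE} ys zs → Unique (xs ++ y ∷ ys ++ zs) →
  All (y ≢_) xs × All (y ≢_) ys × All (y ≢_) zs
unique-middle xs ys zs uq with Unique-resp-↭ (Perm.shift _ xs (ys ++ zs)) uq
... | y∉ ∷ _ = All.++⁻ˡ xs y∉ , All.++⁻ˡ ys (All.++⁻ʳ xs y∉) , All.++⁻ʳ ys (All.++⁻ʳ xs y∉)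

unique-lookup : ∀ {F : List Vertex} {h L₁ L₂} →
  Unique (map proj₁ F) → (h , L₁) ∈ F → (h , L₂) ∈ F → L₁ ≡ L₂
unique-lookup _ (here refl) (here refl) = refl
unique-lookup (h∉ ∷ _) (here refl) (there m) = ⊥-elim (All.lookup (All.map⁻ h∉) m refl)
unique-lookup (h∉ ∷ _) (there m) (here refl) = ⊥-elim (All.lookup (All.map⁻ h∉) m refl)
unique-lookup (_ ∷ uq) (there m) (there m′) = unique-lookup uq m m′

∈-replace : ∀ (X Y Z : List Vertex) {h ℓ h′ L} →
  h ≢ h′ → (h′ , L) ∈ X ++ (h , ℓ) ∷ Y → (h′ , L) ∈ X ++ Z ++ Y
∈-replace X Y Z h≢h′ m with ∈-++⁻ X m
... | inj₁ m₁ = ∈-++⁺ˡ m₁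
... | inj₂ (here refl) = ⊥-elim (h≢h′ refl)
... | inj₂ (there m₂) = ∈-++⁺ʳ X (∈-++⁺ʳ Z m₂)

heads-relabel : ∀ (X Y : List Vertex) h ℓ ℓ′ → map proj₁ (X ++ (h , ℓ′) ∷ Y) ≡ map proj₁ (X ++ (h , ℓ) ∷ Y)
heads-relabel X Y h ℓ ℓ′ = trans (List.map-++ proj₁ X _) (sym (List.map-++ proj₁ X _))

headsOfL-++ : ∀ xs ys → headsOfL (xs ++ ys) ≡ headsOfL xs ++ headsOfL ys
headsOfL-++ [] ys = refl
headsOfL-++ (x ∷ xs) ys =
  trans (cong (headsOf x ++_) (headsOfL-++ xs ys)) (sym (List.++-assoc (headsOf x) (headsOfL xs) (headsOfL ys)))

headsOfL-reverse : ∀ xs → headsOfL (reverse xs) ↭ headsOfL xs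
headsOfL-reverse [] = ↭-refl
headsOfL-reverse (x ∷ xs) = begin
    headsOfL (reverse (x ∷ xs))
  ≡⟨ cong headsOfL (List.unfold-reverse x xs) ⟩
    headsOfL (reverse xs ∷ʳ x)
  ≡⟨ headsOfL-++ (reverse xs) [ x ] ⟩
    headsOfL (reverse xs) ++ headsOf x ++ []
  ≡⟨ cong (headsOfL (reverse xs) ++_) (List.++-identityʳ (headsOf x)) ⟩
    headsOfL (reverse xs) ++ headsOf x
  ↭⟨ Perm.++⁺ʳ (headsOf x) (headsOfL-reverse xs) ⟩
    headsOfL xs ++ headsOf x
  ↭⟨ Perm.++-comm (headsOfL xs) (headsOf x) ⟩
    headsOf x ++ headsOfL xs
  ∎
  where open PermutationReasoning

headsOfL-∷ʳ : ∀ cs T → headsOfL (cs ∷ʳ T) ≡ headsOfL cs ++ headsOf T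
headsOfL-∷ʳ cs T = trans (headsOfL-++ cs [ T ]) (cong (headsOfL cs ++_) (List.++-identityʳ (headsOf T)))

eraseL-++ : ∀ xs ys → eraseL (xs ++ ys) ≡ eraseL xs ++ eraseL ys
eraseL-++ [] ys = refl
eraseL-++ (x ∷ xs) ys = cong (erase x ∷_) (eraseL-++ xs ys)

eraseL-reverse : ∀ xs → eraseL (reverse xs) ≡ reverse (eraseL xs)
eraseL-reverse [] = refl
eraseL-reverse (x ∷ xs) = begin
    eraseL (reverse (x ∷ xs))
  ≡⟨ cong eraseL (List.unfold-reverse x xs) ⟩
    eraseL (reverse xs ∷ʳ x)
  ≡⟨ eraseL-++ (reverse xs) [ x ] ⟩
    eraseL (reverse xs) ∷ʳ erase x
  ≡⟨ cong (_∷ʳ erase x) (eraseL-reverse xs) ⟩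
    reverse (eraseL xs) ∷ʳ erase x
  ≡⟨ sym (List.unfold-reverse (erase x) (eraseL xs)) ⟩
    reverse (eraseL (x ∷ xs))
  ∎
  where open ≡-Reasoning

RootedL-∷ʳ : ∀ {w F L cs t c} → RootedL w F L cs → Edge w t (label c) × Rooted w F c →
  RootedL w F (L ∷ʳ t) (cs ∷ʳ c)
RootedL-∷ʳ [] p = p ∷ []
RootedL-∷ʳ (q ∷ rl) p = q ∷ RootedL-∷ʳ rl p

module Transport {w w′ : Word} {F F′ : List Vertex} (Q : HE → Set)
  (edge : ∀ {t h} → Edge w t h → Edge w′ t h)
  (vertex : ∀ {h L} → Q h → (h , L) ∈ F → (h , L) ∈ F′) where

  rooted : ∀ {t} → All Q (headsOf t) → Rooted w F t → Rooted w′ F′ t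
  rootedL : ∀ {ts cs} → All Q (headsOfL cs) → RootedL w F ts cs → RootedL w′ F′ ts cs
  rooted (q ∷ qs) (rnode m rl) = rnode (vertex q m) (rootedL qs rl)
  rootedL qs [] = []
  rootedL {cs = c ∷ _} qs ((e , r) ∷ rl) =
    (edge e , rooted (All.++⁻ˡ (headsOf c) qs) r) ∷ rootedL (All.++⁻ʳ (headsOf c) qs) rl

  rootedAll : ∀ {ts} → All Q (headsOfL ts) → All (Rooted w F) ts → All (Rooted w′ F′) ts
  rootedAll {[]} qs [] = []
  rootedAll {t ∷ _} qs (r ∷ rs) = rooted (All.++⁻ˡ (headsOf t) qs) r ∷ rootedAll (All.++⁻ʳ (headsOf t) qs) rs

Before : ℕ → HE → Set
Before N (aH i) = i < N
Before N (bH i) = i < N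
Before N _ = ⊤

Before-suc : ∀ {N} h → Before N h → Before (suc N) h
Before-suc (aH i) i<N = ℕ.m≤n⇒m≤1+n i<N
Before-suc (bH i) i<N = ℕ.m≤n⇒m≤1+n i<N
Before-suc root _ = _
Before-suc (aT _) _ = _
Before-suc (bT _) _ = _

aH-fresh : ∀ {N} h → Before N h → aH N ≢ h
aH-fresh (aH i) i<N refl = ℕ.<-irrefl refl i<N

bH-fresh : ∀ {N} h → Before N h → bH N ≢ h
bH-fresh (bH i) i<N refl = ℕ.<-irrefl refl i<N

topHead : List ℕ → HE
topHead [] = root
topHead (c ∷ _) = aH c

-- The trees of a forest F: the dangling ones and the rooting ones, each listed most recent first,
-- with their labels read off the open stacks GA and GB after N letters.
record Decomposition (w : Word) (F : List Vertex) (GA GB : List ℕ) (N : ℕ) : Set where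
  constructor decomposition
  field
    dangling rooting : List LTree
    dangling-labels : map label dangling ≡ map bH GB
    rooting-labels : map label rooting ≡ map aH GA ∷ʳ root
    dangling-rooted : All (Rooted w F) dangling
    rooting-rooted : All (Rooted w F) rooting
    heads↭ : headsOfL dangling ++ headsOfL rooting ↭ map proj₁ F
    heads-unique : Unique (headsOfL dangling ++ headsOfL rooting)
    heads-before : All (Before N) (headsOfL dangling ++ headsOfL rooting)
    λ₀≡ : λ₀ w ≡ just (stackSeq (eraseL dangling) (eraseL rooting))

rooting-nonempty : ∀ GA → map label [] ≢ map aH GA ∷ʳ root
rooting-nonempty [] ()
rooting-nonempty (_ ∷ _) ()

topRooting-label : ∀ GA {h hs} → h ∷ hs ≡ map aH GA ∷ʳ root → h ≡ topHead GA
topRooting-label [] e = List.∷-injectiveˡ e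
topRooting-label (_ ∷ _) e = List.∷-injectiveˡ e

decomposition-a : ∀ {w F GA GB N} → Decomposition w F GA GB N →
  Decomposition (w ∷ʳ a) ((aH N , []) ∷ F) (N ∷ GA) GB (suc N)
decomposition-a {w} {F} {N = N} (decomposition D R lD lR rD rR hp hu hb λ≡) =
  decomposition D (lnode (aH N) [] ∷ R) lD (cong (aH N ∷_) lR)
    (T.rootedAll (All.universal _ (headsOfL D)) rD)
    (rnode (here refl) [] ∷ T.rootedAll (All.universal _ (headsOfL R)) rR)
    (↭-trans shifted (prep (aH N) hp))
    (Unique-resp-↭ (↭-sym shifted) (All.map (λ {h} → aH-fresh h) hb ∷ hu))
    (Perm.All-resp-↭ (↭-sym shifted) (ℕ.n<1+n N ∷ All.map (λ {h} → Before-suc h) hb))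
    (λ₀-∷ʳ w a λ≡ (λstep-a (eraseL D) (eraseL R)))
  where
  shifted : headsOfL D ++ aH N ∷ headsOfL R ↭ aH N ∷ headsOfL D ++ headsOfL R
  shifted = Perm.shift (aH N) (headsOfL D) (headsOfL R)
  module T = Transport {w} {w ∷ʳ a} {F} {(aH N , []) ∷ F} (λ _ → ⊤) (Edge-∷ʳ w a) (λ _ m → there m)

heads-insert : ∀ (P R : List Vertex) {h ℓ h′ ℓ′ ℓ″ hs} → hs ↭ map proj₁ (P ++ (h , ℓ) ∷ R) →
  h′ ∷ hs ↭ map proj₁ (P ++ (h′ , ℓ′) ∷ (h , ℓ″) ∷ R)
heads-insert P R {h} {ℓ} {h′} {ℓ′} {ℓ″} {hs} hs↭ = begin
    h′ ∷ hs
  ↭⟨ prep h′ hs↭ ⟩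
    h′ ∷ map proj₁ (P ++ (h , ℓ) ∷ R)
  ≡⟨ cong (h′ ∷_) (List.map-++ proj₁ P ((h , ℓ) ∷ R)) ⟩
    h′ ∷ map proj₁ P ++ h ∷ map proj₁ R
  ↭⟨ ↭-sym (Perm.shift h′ (map proj₁ P) (h ∷ map proj₁ R)) ⟩
    map proj₁ P ++ h′ ∷ h ∷ map proj₁ R
  ≡⟨ List.map-++ proj₁ P ((h′ , ℓ′) ∷ (h , ℓ″) ∷ R) ⟨
    map proj₁ (P ++ (h′ , ℓ′) ∷ (h , ℓ″) ∷ R)
  ∎
  where open PermutationReasoning

-- Reading b splits the top rooting vertex: its tails so far now hang from the new dangling head.
decomposition-b : ∀ {w GA GB N P R ℓ} → Decomposition w (P ++ (topHead GA , ℓ) ∷ R) GA GB N →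
  Decomposition (w ∷ʳ b) (P ++ (bH N , ℓ) ∷ (topHead GA , []) ∷ R) GA (N ∷ GB) (suc N)
decomposition-b {GA = GA} (decomposition _ [] _ lR _ _ _ _ _ _) = ⊥-elim (rooting-nonempty GA lR)
decomposition-b {w} {GA} {GB} {N} {P} {R} {ℓ}
  (decomposition D (lnode h cs ∷ R′) lD lR rD (rnode m rl ∷ rR′) hp hu hb λ≡)
  with refl ← topRooting-label GA lR =
  decomposition (lnode (bH N) cs ∷ D) (lnode h [] ∷ R′) (cong (bH N ∷_) lD) lR
    (rnode (∈-++⁺ʳ P (here refl)) (T.rootedL (proj₁ (proj₂ h∉)) rl′) ∷ T.rootedAll (proj₁ h∉) rD)
    (rnode (∈-++⁺ʳ P (there (here refl))) [] ∷ T.rootedAll (proj₂ (proj₂ h∉)) rR′)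
    (heads-insert P R (↭-trans reorder hp))
    (Perm.All-resp-↭ (↭-sym reorder) (All.map (λ {h′} → bH-fresh h′) hb) ∷ Unique-resp-↭ (↭-sym reorder) hu)
    (ℕ.n<1+n N ∷ Perm.All-resp-↭ (↭-sym reorder) (All.map (λ {h′} → Before-suc h′) hb))
    (λ₀-∷ʳ w b λ≡ (λstep-b (eraseL D) (node (eraseL cs)) (eraseL R′)))
  where
  F : List Vertex
  F = P ++ (h , ℓ) ∷ R
  HD Hcs HR′ : List HE
  HD = headsOfL D
  Hcs = headsOfL cs
  HR′ = headsOfL R′
  h∉ : All (h ≢_) HD × All (h ≢_) Hcs × All (h ≢_) HR′
  h∉ = unique-middle HD Hcs HR′ hu
  module T = Transport (h ≢_) (Edge-∷ʳ w b) (λ h≢ m → ∈-replace P R ((bH N , ℓ) ∷ (h , []) ∷ []) h≢ m)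
  rl′ : RootedL w F ℓ cs
  rl′ = subst (λ L → RootedL w F L cs) (unique-lookup (Unique-resp-↭ hp hu) m (∈-++⁺ʳ P (here refl))) rl
  reorder : (Hcs ++ HD) ++ h ∷ HR′ ↭ HD ++ h ∷ Hcs ++ HR′
  reorder = begin
      (Hcs ++ HD) ++ h ∷ HR′
    ≡⟨ List.++-assoc Hcs HD (h ∷ HR′) ⟩
      Hcs ++ HD ++ h ∷ HR′
    ↭⟨ Perm.shifts Hcs HD ⟩
      HD ++ Hcs ++ h ∷ HR′
    ↭⟨ Perm.++⁺ˡ HD (Perm.shift h Hcs HR′) ⟩
      HD ++ h ∷ Hcs ++ HR′
    ∎
    where open PermutationReasoning

graft : ∀ {w w′ F F′ h ℓ t cs T₁} →
  (∀ {t′ h′} → Edge w t′ h′ → Edge w′ t′ h′) → (∀ {h′ L} → h ≢ h′ → (h′ , L) ∈ F → (h′ , L) ∈ F′) →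
  Unique (map proj₁ F) → (h , ℓ) ∈ F → (h , ℓ ∷ʳ t) ∈ F′ → All (h ≢_) (headsOfL (cs ∷ʳ T₁)) →
  Rooted w F (lnode h cs) → Rooted w F T₁ → Edge w′ t (label T₁) → Rooted w′ F′ (lnode h (cs ∷ʳ T₁))
graft {w} {F = F} {h = h} {ℓ} {cs = cs} {T₁} edge vertex uF m m′ h∉ (rnode m₀ rl) r₁ e =
  rnode m′ (RootedL-∷ʳ (T.rootedL (All.++⁻ˡ (headsOfL cs) h∉′) rl′)
                      (e , T.rooted (All.++⁻ʳ (headsOfL cs) h∉′) r₁))
  where
  module T = Transport (h ≢_) edge vertex
  h∉′ : All (h ≢_) (headsOfL cs ++ headsOf T₁)
  h∉′ = subst (All (h ≢_)) (headsOfL-∷ʳ cs T₁) h∉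
  rl′ : RootedL w F ℓ cs
  rl′ = subst (λ L → RootedL w F L cs) (unique-lookup uF m₀ m) rl

graft-heads : ∀ h cs T₁ Y → h ∷ headsOfL (cs ∷ʳ T₁) ++ Y ↭ headsOf T₁ ++ h ∷ headsOfL cs ++ Y
graft-heads h cs T₁ Y = begin
    h ∷ headsOfL (cs ∷ʳ T₁) ++ Y
  ≡⟨ cong (λ hs → h ∷ hs ++ Y) (headsOfL-∷ʳ cs T₁) ⟩
    h ∷ (headsOfL cs ++ headsOf T₁) ++ Y
  ≡⟨ cong (h ∷_) (List.++-assoc (headsOfL cs) (headsOf T₁) Y) ⟩
    h ∷ headsOfL cs ++ headsOf T₁ ++ Y
  ↭⟨ prep h (Perm.shifts (headsOfL cs) (headsOf T₁)) ⟩
    h ∷ headsOf T₁ ++ headsOfL cs ++ Y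
  ↭⟨ ↭-sym (Perm.shift h (headsOf T₁) (headsOfL cs ++ Y)) ⟩
    headsOf T₁ ++ h ∷ headsOfL cs ++ Y
  ∎
  where open PermutationReasoning

erase-graft : ∀ h cs T₁ → σ (erase T₁) (erase (lnode h cs)) ≡ erase (lnode h (cs ∷ʳ T₁))
erase-graft h cs T₁ = cong node (sym (eraseL-++ cs [ T₁ ]))

-- Reading b̅ attaches the most recent dangling tree to the top rooting vertex through the new tail.
decomposition-b̅ : ∀ {w GA p GB N P R ℓ} → paired (w ∷ʳ b̅) p N ≡ true →
  Decomposition w (P ++ (topHead GA , ℓ) ∷ R) GA (p ∷ GB) N →
  Decomposition (w ∷ʳ b̅) (P ++ (topHead GA , ℓ ∷ʳ bT N) ∷ R) GA GB (suc N)
decomposition-b̅ {GA = GA} _ (decomposition _ [] _ lR _ _ _ _ _ _) = ⊥-elim (rooting-nonempty GA lR)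
decomposition-b̅ _ (decomposition [] (_ ∷ _) () _ _ _ _ _ _ _)
decomposition-b̅ {w} {GA} {p} {GB} {N} {P} {R} {ℓ} p~N
  (decomposition (T₁ ∷ D) (lnode h cs ∷ R′) lD lR (r₁ ∷ rD) (rh ∷ rR′) hp hu hb λ≡)
  with refl ← topRooting-label GA lR =
  decomposition D (lnode h (cs ∷ʳ T₁) ∷ R′) (List.∷-injectiveʳ lD) lR
    (T.rootedAll (proj₁ h∉) rD)
    (graft (Edge-∷ʳ w b̅) vertex (Unique-resp-↭ hp hu) (∈-++⁺ʳ P (here refl)) (∈-++⁺ʳ P (here refl))
           (proj₁ (proj₂ h∉)) rh r₁ edge
     ∷ T.rootedAll (proj₂ (proj₂ h∉)) rR′)
    (↭-trans reorder (↭-trans hp (↭-reflexive (sym (heads-relabel P R h ℓ (ℓ ∷ʳ bT N))))))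
    unique′
    (Perm.All-resp-↭ (↭-sym reorder) (All.map (λ {h′} → Before-suc h′) hb))
    (λ₀-∷ʳ w b̅ λ≡ (trans (λstep-b̅ (erase T₁) (eraseL D) (node (eraseL cs)) (eraseL R′))
                          (cong (λ T → just (stackSeq (eraseL D) (T ∷ eraseL R′))) (erase-graft h cs T₁))))
  where
  HD Hcs HR′ : List HE
  HD = headsOfL D
  Hcs = headsOfL cs
  HR′ = headsOfL R′
  reorder : HD ++ h ∷ headsOfL (cs ∷ʳ T₁) ++ HR′ ↭ (headsOf T₁ ++ HD) ++ h ∷ Hcs ++ HR′
  reorder = begin
      HD ++ h ∷ headsOfL (cs ∷ʳ T₁) ++ HR′
    ↭⟨ Perm.++⁺ˡ HD (graft-heads h cs T₁ HR′) ⟩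
      HD ++ headsOf T₁ ++ h ∷ Hcs ++ HR′
    ↭⟨ Perm.shifts HD (headsOf T₁) ⟩
      headsOf T₁ ++ HD ++ h ∷ Hcs ++ HR′
    ≡⟨ sym (List.++-assoc (headsOf T₁) HD (h ∷ Hcs ++ HR′)) ⟩
      (headsOf T₁ ++ HD) ++ h ∷ Hcs ++ HR′
    ∎
    where open PermutationReasoning
  unique′ : Unique (HD ++ h ∷ headsOfL (cs ∷ʳ T₁) ++ HR′)
  unique′ = Unique-resp-↭ (↭-sym reorder) hu
  h∉ : All (h ≢_) HD × All (h ≢_) (headsOfL (cs ∷ʳ T₁)) × All (h ≢_) HR′
  h∉ = unique-middle HD (headsOfL (cs ∷ʳ T₁)) HR′ unique′
  vertex : ∀ {h′ L} → h ≢ h′ → (h′ , L) ∈ P ++ (h , ℓ) ∷ R → (h′ , L) ∈ P ++ (h , ℓ ∷ʳ bT N) ∷ R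
  vertex = ∈-replace P R ((h , ℓ ∷ʳ bT N) ∷ [])
  module T = Transport (h ≢_) (Edge-∷ʳ w b̅) vertex
  edge : Edge (w ∷ʳ b̅) (bT N) (label T₁)
  edge = subst (Edge (w ∷ʳ b̅) (bT N)) (sym (List.∷-injectiveˡ lD)) (bEdge p N p~N)

-- Reading a̅ closes the top edge: the top rooting tree becomes the last child of the vertex below it.
decomposition-a̅ : ∀ {w c K GB N X R F′ ℓ} → F′ ↭ X ++ (topHead K , ℓ ∷ʳ aT c) ∷ R →
  Decomposition w (X ++ (topHead K , ℓ) ∷ R) (c ∷ K) GB N → Decomposition (w ∷ʳ a̅) F′ K GB (suc N)
decomposition-a̅ _ (decomposition _ [] _ () _ _ _ _ _ _)
decomposition-a̅ {K = K} _ (decomposition _ (_ ∷ []) _ lR _ _ _ _ _ _) =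
  ⊥-elim (rooting-nonempty K (List.∷-injectiveʳ lR))
decomposition-a̅ {w} {c} {K} {GB} {N} {X} {R} {F′} {ℓ} F′↭
  (decomposition D (T₁ ∷ lnode h cs ∷ R′) lD lR rD (r₁ ∷ rh ∷ rR′) hp hu hb λ≡)
  with refl ← topRooting-label K (List.∷-injectiveʳ lR) =
  decomposition D (lnode h (cs ∷ʳ T₁) ∷ R′) lD (List.∷-injectiveʳ lR)
    (T.rootedAll (proj₁ h∉) rD)
    (graft (Edge-∷ʳ w a̅) vertex (Unique-resp-↭ hp hu) (∈-++⁺ʳ X (here refl))
           (Perm.∈-resp-↭ (↭-sym F′↭) (∈-++⁺ʳ X (here refl))) (proj₁ (proj₂ h∉)) rh r₁ edge
     ∷ T.rootedAll (proj₂ (proj₂ h∉)) rR′)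
    (↭-trans reorder (↭-trans hp (↭-trans (↭-reflexive (sym (heads-relabel X R h ℓ (ℓ ∷ʳ aT c))))
                                          (Perm.map⁺ proj₁ (↭-sym F′↭)))))
    unique′
    (Perm.All-resp-↭ (↭-sym reorder) (All.map (λ {h′} → Before-suc h′) hb))
    (λ₀-∷ʳ w a̅ λ≡ (trans (λstep-a̅ (eraseL D) (erase T₁) (node (eraseL cs)) (eraseL R′))
                          (cong (λ T → just (stackSeq (eraseL D) (T ∷ eraseL R′))) (erase-graft h cs T₁))))
  where
  HD HR′ : List HE
  HD = headsOfL D
  HR′ = headsOfL R′
  reorder : HD ++ h ∷ headsOfL (cs ∷ʳ T₁) ++ HR′ ↭ HD ++ headsOf T₁ ++ h ∷ headsOfL cs ++ HR′
  reorder = Perm.++⁺ˡ HD (graft-heads h cs T₁ HR′)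
  unique′ : Unique (HD ++ h ∷ headsOfL (cs ∷ʳ T₁) ++ HR′)
  unique′ = Unique-resp-↭ (↭-sym reorder) hu
  h∉ : All (h ≢_) HD × All (h ≢_) (headsOfL (cs ∷ʳ T₁)) × All (h ≢_) HR′
  h∉ = unique-middle HD (headsOfL (cs ∷ʳ T₁)) HR′ unique′
  vertex : ∀ {h′ L} → h ≢ h′ → (h′ , L) ∈ X ++ (h , ℓ) ∷ R → (h′ , L) ∈ F′
  vertex h≢ m = Perm.∈-resp-↭ (↭-sym F′↭) (∈-replace X R ((h , ℓ ∷ʳ aT c) ∷ []) h≢ m)
  module T = Transport (h ≢_) (Edge-∷ʳ w a̅) vertex
  edge : Edge (w ∷ʳ a̅) (aT c) (label T₁)
  edge = subst (Edge (w ∷ʳ a̅) (aT c)) (sym (List.∷-injectiveˡ lR)) (aEdge c)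

path-top : ∀ {G n mc K h inc s} → OpenPath G n mc K ((h , inc) ∷ s) → h ≡ topHead K
path-top (rootPath _) = refl
path-top (_ ◂ _) = refl

forestOf-top : ∀ h inc s d → forestOf (st ((h , inc) ∷ s) d) ≡ pieces inc ++ (h , trailingTails inc) ∷ forestBelow s d
forestOf-top h inc s d =
  trans (cong (_++ forestBelow s d) (explode-close h inc))
        (List.++-assoc (pieces inc) ((h , trailingTails inc) ∷ []) (forestBelow s d))

forestOf-top-head : ∀ h y inc s d → isHead y ≡ true →
  forestOf (st ((h , y ∷ inc) ∷ s) d) ≡ pieces inc ++ (y , trailingTails inc) ∷ (h , []) ∷ forestBelow s d
forestOf-top-head h y inc s d hd =
  trans (cong (_++ forestBelow s d) (explode-close-head h y inc hd))
        (List.++-assoc (pieces inc) ((y , trailingTails inc) ∷ (h , []) ∷ []) (forestBelow s d))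

forestOf-top-tail : ∀ h y inc s d → isHead y ≡ false →
  forestOf (st ((h , y ∷ inc) ∷ s) d) ≡ pieces inc ++ (h , trailingTails inc ∷ʳ y) ∷ forestBelow s d
forestOf-top-tail h y inc s d tl =
  trans (cong (_++ forestBelow s d) (explode-close-tail h y inc tl))
        (List.++-assoc (pieces inc) ((h , trailingTails inc ∷ʳ y) ∷ []) (forestBelow s d))

-- The closed vertex joins the finished ones, so the new forest is the expected one only up to order.
decomposition-pop : ∀ {w c K GB N inc inc₂ s d} →
  Decomposition w (forestOf (st ((aH c , inc) ∷ (topHead K , aT c ∷ inc₂) ∷ s) d)) (c ∷ K) GB N →
  Decomposition (w ∷ʳ a̅) (forestOf (st ((topHead K , aT c ∷ inc₂) ∷ s) (close (aH c , inc) ∷ d))) K GB (suc N)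
decomposition-pop {w} {c} {K} {GB} {N} {inc} {inc₂} {s} {d} I =
  decomposition-a̅ F′↭ (subst (λ F → Decomposition w F (c ∷ K) GB N) F≡ I)
  where
  h : HE
  h = topHead K
  E R X : List Vertex
  E = explode (close (aH c , inc))
  R = forestBelow s d
  X = E ++ pieces inc₂
  F≡ : E ++ forestOf (st ((h , inc₂) ∷ s) d) ≡ X ++ (h , trailingTails inc₂) ∷ R
  F≡ = trans (cong (E ++_) (forestOf-top h inc₂ s d)) (sym (List.++-assoc E (pieces inc₂) _))
  F′↭ : forestOf (st ((h , aT c ∷ inc₂) ∷ s) (close (aH c , inc) ∷ d)) ↭
        X ++ (h , trailingTails inc₂ ∷ʳ aT c) ∷ R
  F′↭ = begin
      explode (close (h , aT c ∷ inc₂)) ++ forestBelow s (close (aH c , inc) ∷ d)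
    ≡⟨ cong (_++ forestBelow s (close (aH c , inc) ∷ d)) (explode-close-tail h (aT c) inc₂ refl) ⟩
      Y ++ forestBelow s (close (aH c , inc) ∷ d)
    ↭⟨ Perm.++⁺ˡ Y (forestBelow-∷-closed s (close (aH c , inc)) d) ⟩
      Y ++ E ++ R
    ↭⟨ Perm.shifts Y E ⟩
      E ++ Y ++ R
    ≡⟨ cong (E ++_) (List.++-assoc (pieces inc₂) ((h , trailingTails inc₂ ∷ʳ aT c) ∷ []) R) ⟩
      E ++ pieces inc₂ ++ (h , trailingTails inc₂ ∷ʳ aT c) ∷ R
    ≡⟨ sym (List.++-assoc E (pieces inc₂) _) ⟩
      X ++ (h , trailingTails inc₂ ∷ʳ aT c) ∷ R
    ∎
    where
    Y : List Vertex
    Y = pieces inc₂ ++ (h , trailingTails inc₂ ∷ʳ aT c) ∷ []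
    open PermutationReasoning

decomposition-step : ∀ {w GA GB N σ} x → OpenPath GA N nothing GA (TourState.stack σ) →
  (x ≡ a̅ → GA ≢ []) → (x ≡ b̅ → GB ≢ []) → (∀ {p GB′} → GB ≡ p ∷ GB′ → paired (w ∷ʳ b̅) p N ≡ true) →
  Decomposition w (forestOf σ) GA GB N →
  Decomposition (w ∷ʳ x) (forestOf (step N x σ)) (updateStack kindA N x GA) (updateStack kindB N x GB) (suc N)
decomposition-step {σ = st (_ ∷ _) _} a _ _ _ _ I = decomposition-a I
decomposition-step {w} {GA} {GB} {N} {st ((h , inc) ∷ s) d} b p _ _ _ I with refl ← path-top p =
  subst (λ F → Decomposition (w ∷ʳ b) F GA (N ∷ GB) (suc N)) (sym (forestOf-top-head h (bH N) inc s d refl))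
    (decomposition-b (subst (λ F → Decomposition w F GA GB N) (forestOf-top h inc s d) I))
decomposition-step {GB = []} {σ = st (_ ∷ _) _} b̅ _ _ nonempty _ _ = ⊥-elim (nonempty refl refl)
decomposition-step {w} {GA} {q ∷ GB} {N} {st ((h , inc) ∷ s) d} b̅ p _ _ q~N I with refl ← path-top p =
  subst (λ F → Decomposition (w ∷ʳ b̅) F GA GB (suc N)) (sym (forestOf-top-tail h (bT N) inc s d refl))
    (decomposition-b̅ (q~N refl) (subst (λ F → Decomposition w F GA (q ∷ GB) N) (forestOf-top h inc s d) I))
decomposition-step {GA = []} {σ = st (_ ∷ _) _} a̅ _ nonempty _ _ _ = ⊥-elim (nonempty refl refl)
decomposition-step {GA = _ ∷ _} {σ = st _ d} a̅ (top {inc = inc} _ ◂ rootPath (below {inc = inc₂} _)) _ _ _ I =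
  decomposition-pop {inc = inc} {inc₂} {[]} {d} I
decomposition-step {GA = _ ∷ _} {σ = st _ d} a̅ (top {inc = inc} _ ◂ _◂_ {s = s} (below {inc = inc₂} _) _) _ _ _ I =
  decomposition-pop {inc = inc} {inc₂} {s} {d} I

Balanced : Word → Set
Balanced z = (count a z ≥ count a̅ z) × (count b z ≥ count b̅ z)

prefixShuffle-init : ∀ w x → PrefixShuffle (w ∷ʳ x) → PrefixShuffle w
prefixShuffle-init w x ps n with n ℕ.≤? length w
... | yes n≤ = subst Balanced (take-++-≤ n w [ x ] n≤) (ps n)
... | no n≰ = subst Balanced whole (ps (length w))
  where
  whole : take (length w) (w ∷ʳ x) ≡ take n w
  whole = trans (take-++-≤ (length w) w [ x ] ℕ.≤-refl)
                (trans (List.take-all (length w) w ℕ.≤-refl) (sym (List.take-all n w (ℕ.<⇒≤ (ℕ.≰⇒> n≰)))))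

closers≤openers : ∀ k {w} → PrefixShuffle w → count (closing k) w ≤ count (opening k) w
closers≤openers kindA {w} ps = subst (λ z → count a̅ z ≤ count a z) (List.take-all (length w) w ℕ.≤-refl)
                                     (proj₁ (ps (length w)))
closers≤openers kindB {w} ps = subst (λ z → count b̅ z ≤ count b z) (List.take-all (length w) w ℕ.≤-refl)
                                     (proj₂ (ps (length w)))

count-closing-∷ʳ : ∀ k w → count (closing k) (w ∷ʳ closing k) ≡ suc (count (closing k) w)
count-closing-∷ʳ kindA w = count-∷ʳ a̅ w a̅
count-closing-∷ʳ kindB w = count-∷ʳ b̅ w b̅

count-opening-∷ʳ : ∀ k w → count (opening k) (w ∷ʳ closing k) ≡ count (opening k) w
count-opening-∷ʳ kindA w = count-∷ʳ a w a̅
count-opening-∷ʳ kindB w = count-∷ʳ b w b̅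

opener-before-closer : ∀ k {w} → PrefixShuffle (w ∷ʳ closing k) → openStack k w ≢ []
opener-before-closer k {w} ps empty = ℕ.<-irrefl refl (begin-strict
    count (closing k) w
  <⟨ ℕ.n<1+n _ ⟩
    suc (count (closing k) w)
  ≡⟨ count-closing-∷ʳ k w ⟨
    count (closing k) (w ∷ʳ closing k)
  ≤⟨ closers≤openers k ps ⟩
    count (opening k) (w ∷ʳ closing k)
  ≡⟨ count-opening-∷ʳ k w ⟩
    count (opening k) w
  ≤⟨ unclosed-bound (stackSpec k w) ⟩
    count (closing k) w + length (openStack k w)
  ≡⟨ cong (λ K → count (closing k) w + length K) empty ⟩
    count (closing k) w + 0
  ≡⟨ ℕ.+-identityʳ _ ⟩
    count (closing k) w
  ∎)
  where open ℕ.≤-Reasoning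

closer-pairs-top : ∀ k {w p K} → openStack k w ≡ p ∷ K → paired (w ∷ʳ closing k) p (length w) ≡ true
closer-pairs-top k {w} {p} {K} e =
  trans (paired-last s (closing k) opener)
        (cong₂ _∧_ (isL-refl (closing k)) (trans (cong (isTop p) e) (≡ᵇ-refl p)))
  where
  s : StackSpec k w
  s = stackSpec k w
  opener : isAt w p (opening k) ≡ true
  opener = proj₂ (All.head (subst (All (λ i → i < length w × isAt w i (opening k) ≡ true)) e (openers s)))

filterᵇ-cong : ∀ {f g : ℕ → Bool} {xs} → All (λ x → f x ≡ g x) xs →
  filter (λ i → T? (f i)) xs ≡ filter (λ i → T? (g i)) xs
filterᵇ-cong [] = refl
filterᵇ-cong {f} {g} {x ∷ xs} (e ∷ es) rewrite e with g x
... | true = cong (x ∷_) (filterᵇ-cong es)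
... | false = filterᵇ-cong es

filter-mem-upTo : ∀ n {K} → AllPairs _>_ K → All (_< n) K → filter (λ i → T? (mem i K)) (upTo n) ≡ reverse K
filter-mem-upTo zero {[]} _ _ = refl
filter-mem-upTo zero {_ ∷ _} _ (() ∷ _)
filter-mem-upTo (suc n) {K} desc K<1+n = begin
    filter (member K) (upTo (suc n))
  ≡⟨ cong (filter (member K)) (sym (List.upTo-∷ʳ n)) ⟩
    filter (member K) (upTo n ∷ʳ n)
  ≡⟨ List.filter-++ (member K) (upTo n) [ n ] ⟩
    filter (member K) (upTo n) ++ filter (member K) [ n ]
  ≡⟨ split K desc K<1+n ⟩
    reverse K
  ∎
  where
  open ≡-Reasoning
  member : (K : List ℕ) (i : ℕ) → Dec (T (mem i K))
  member K i = T? (mem i K)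
  split : ∀ K → AllPairs _>_ K → All (_< suc n) K → filter (member K) (upTo n) ++ filter (member K) [ n ] ≡ reverse K
  split [] _ _ = trans (List.++-identityʳ _) (filter-mem-upTo n [] [])
  split (j ∷ K) (K<j ∷ desc) (j≤n ∷ _) with ℕ.m≤n⇒m<n∨m≡n (ℕ.≤-pred j≤n)
  ... | inj₁ j<n rewrite mem-fresh {n} {j ∷ K} (j<n ∷ All.map (λ k<j → ℕ.<-trans k<j j<n) K<j) =
    trans (List.++-identityʳ _) (filter-mem-upTo n (K<j ∷ desc) (j<n ∷ All.map (λ k<j → ℕ.<-trans k<j j<n) K<j))
  ... | inj₂ refl rewrite mem-here j K = begin
      filter (member (j ∷ K)) (upTo j) ∷ʳ j
    ≡⟨ cong (_∷ʳ j) (filterᵇ-cong (All.map (λ {i} i<j → cong (_∨ mem i K) (<⇒≡ᵇ-false i<j)) (all-upTo j))) ⟩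
      filter (member K) (upTo j) ∷ʳ j
    ≡⟨ cong (_∷ʳ j) (filter-mem-upTo j desc K<j) ⟩
      reverse K ∷ʳ j
    ≡⟨ List.unfold-reverse j K ⟨
      reverse (j ∷ K)
    ∎

unpairedOpeners≡openStack : ∀ k w →
  filter (λ i → T? (isAt w i (opening k) ∧ unpaired w i)) (positions w) ≡ reverse (openStack k w)
unpairedOpeners≡openStack k w =
  trans (filterᵇ-cong (All.universal (unpaired≡mem s) (upTo (length w))))
        (filter-mem-upTo (length w) (descending s) (All.map proj₁ (openers s)))
  where
  s : StackSpec k w
  s = stackSpec k w

Invariant : Word → Set
Invariant w = TourSpec w × Decomposition w (forest w) (openStack kindA w) (openStack kindB w) (length w)

invariant-[] : Invariant []
invariant-[] = tourSpec-[] ,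
  decomposition [] (lnode root [] ∷ []) refl refl [] (rnode (here refl) [] ∷ []) ↭-refl ([] ∷ []) (_ ∷ []) refl

invariant-∷ʳ : ∀ {w} x → PrefixShuffle (w ∷ʳ x) → Invariant w → Invariant (w ∷ʳ x)
invariant-∷ʳ {w} x ps (t , I) = t′ , J
  where
  nonemptyA : x ≡ a̅ → openStack kindA w ≢ []
  nonemptyA refl = opener-before-closer kindA ps
  nonemptyB : x ≡ b̅ → openStack kindB w ≢ []
  nonemptyB refl = opener-before-closer kindB ps
  t′ : TourSpec (w ∷ʳ x)
  t′ = tourSpec-∷ʳ x (stackSpec kindA w) nonemptyA t
  J : Decomposition (w ∷ʳ x) (forest (w ∷ʳ x)) (openStack kindA (w ∷ʳ x)) (openStack kindB (w ∷ʳ x)) (length (w ∷ʳ x))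
  J rewrite forest≡forestOf (w ∷ʳ x) (stackSpec kindA (w ∷ʳ x)) t′ | tour-∷ʳ w x
          | openStack-∷ʳ kindA w x | openStack-∷ʳ kindB w x | length-∷ʳ w x =
    decomposition-step x (proj₁ t) nonemptyA nonemptyB (closer-pairs-top kindB {w})
      (subst (λ F → Decomposition w F (openStack kindA w) (openStack kindB w) (length w))
             (forest≡forestOf w (stackSpec kindA w) t) I)

invariant : ∀ w → PrefixShuffle w → Invariant w
invariant w = go (reverseView w)
  where
  go : ∀ {w} → Reverse w → PrefixShuffle w → Invariant w
  go [] _ = invariant-[]
  go (w ∶ r ∶ʳ x) ps = invariant-∷ʳ x ps (go r (prefixShuffle-init w x ps))

danglingHeads≡ : ∀ w → danglingHeads w ≡ reverse (map bH (openStack kindB w))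
danglingHeads≡ w = trans (cong (map bH) (unpairedOpeners≡openStack kindB w)) (List.reverse-map bH (openStack kindB w))

rootingHeads≡ : ∀ w → rootingHeads w ≡ reverse (map aH (openStack kindA w) ∷ʳ root)
rootingHeads≡ w = trans (cong (λ K → root ∷ map aH K) (unpairedOpeners≡openStack kindA w))
                        (trans (cong (root ∷_) (List.reverse-map aH (openStack kindA w)))
                               (sym (List.reverse-++ (map aH (openStack kindA w)) [ root ])))

map-label-reverse : ∀ {ts hs} → map label ts ≡ hs → map label (reverse ts) ≡ reverse hs
map-label-reverse {ts} e = trans (List.reverse-map label ts) (cong reverse e)

proposition3 : (w : Word) → PrefixShuffle w →
    Σ (List LTree) λ ts → Σ (List LTree) λ ts′ →
      (map label ts ≡ danglingHeads w)
      × (map label ts′ ≡ rootingHeads w)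
      × All (Rooted w (forest w)) ts
      × All (Rooted w (forest w)) ts′
      × ((headsOfL ts ++ headsOfL ts′) ↭ map proj₁ (forest w))
      × (λ₀ w ≡ just (expectedSeq (eraseL ts) (eraseL ts′)))
proposition3 w ps with invariant w ps
... | _ , decomposition D R lD lR rD rR hp _ _ λ≡ =
  reverse D , reverse R ,
  trans (map-label-reverse lD) (sym (danglingHeads≡ w)) ,
  trans (map-label-reverse lR) (sym (rootingHeads≡ w)) ,
  All-reverse rD , All-reverse rR ,
  ↭-trans (Perm.++⁺ (headsOfL-reverse D) (headsOfL-reverse R)) hp ,
  trans λ≡ (cong just (trans (stackSeq≡expectedSeq (eraseL D) (eraseL R))
                             (sym (cong₂ expectedSeq (eraseL-reverse D) (eraseL-reverse R)))))
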